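{- Let $N \geq 1$ and $n\ge 0$ be integers with $2n > N$. Then \[ S_{N}(n) = \frac{(2n)!}{(2n-N)!}\, \beta^{2n-N+1}\, 2^{1-N} N \; {}_2F_1\!\left( \begin{matrix} 1-N, \; 1+\beta \\ 2 \end{matrix} \,\Big|\, 2 \right), \] interpreted in the symbolic (umbral) sense described in the context.
   Context: $B_m$ denotes the classical Bernoulli numbers, $\sum_{m\ge0} B_m z^m/m! = z/(e^z-1)$. For integers $N\ge 1$, $n\ge 0$, \[ S_{N}(n) := \sum_{j_1+\cdots+j_N=n} \frac{(2n)!}{(2j_{1})! \cdots (2j_{N})!} B_{2j_{1}} \cdots B_{2j_{N}}, \] the sum over all $N$-tuples of nonnegative integers with $j_1+\cdots+j_N=n$. ${}_2F_1\!\left(\begin{smallmatrix} a,\, b\\ c\end{smallmatrix}\big| x\right)=\sum_{\ell\ge0}\frac{(a)_\ell (b)_\ell}{(c)_\ell\,\ell!}x^\ell$ with $(x)_\ell=x(x+1)\cdots(x+\ell-1)$; since $1-N\le 0$ it is a polynomial in $\beta$. Symbolic convention: $\beta$ is an indeterminate; the right-hand side is first fully expanded as a polynomial in $\beta$, and only afterwards each monomial $\beta^{j}$ is replaced by $B_j/j$ (all exponents occurring are $\ge 2$). -}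

module Defs where

open import Data.Nat as ℕ using (ℕ; zero; suc; _∸_; NonZero; _!)
open import Data.Nat.Properties using (_!≢0; m^n≢0; m*n≢0)
open import Data.Nat.Combinatorics using (_C_)
open import Data.Integer as ℤ using (ℤ)
open import Data.Rational using (ℚ; 0ℚ; 1ℚ; _+_; _*_; -_) renaming (_/_ to _//_)
open import Data.List using (List; []; _∷_; _++_; [_]; foldr; map; upTo; concatMap; replicate; zipWith)
open import Data.Vec using (Vec; []; _∷_)

ℕtoℚ : ℕ → ℚ
ℕtoℚ k = (ℤ.+ k) // 1

recipℕ : (d : ℕ) → .{{_ : NonZero d}} → ℚ
recipℕ d = (ℤ.+ 1) // d

sumℚ : List ℚ → ℚ
sumℚ = foldr _+_ 0ℚ

powℚ : ℚ → ℕ → ℚ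
powℚ q zero    = 1ℚ
powℚ q (suc k) = powℚ q k * q

nth : List ℚ → ℕ → ℚ
nth []       _       = 0ℚ
nth (x ∷ xs) zero    = x
nth (x ∷ xs) (suc k) = nth xs k

-- Bernoulli numbers, convention Σ B_m z^m/m! = z/(e^z - 1)  (B_1 = -1/2),
-- via the equivalent recurrence  B_0 = 1,  Σ_{k=0}^{m} C(m+1,k) B_k = 0 (m ≥ 1).

bernNext : ℕ → List ℚ → ℚ
bernNext zero    bs = 1ℚ
bernNext (suc m) bs =
  - (recipℕ (suc (suc m)) *
      sumℚ (zipWith (λ k b → ℕtoℚ (suc (suc m) C k) * b) (upTo (suc m)) bs))

bernList : ℕ → List ℚ
bernList zero    = []
bernList (suc m) = bernList m ++ [ bernNext m (bernList m) ]

B : ℕ → ℚ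
B m = nth (bernList (suc m)) m

-- S_N(n) = Σ_{j_1+…+j_N = n} (2n)!/((2j_1)!⋯(2j_N)!) B_{2j_1}⋯B_{2j_N}

comps : (N n : ℕ) → List (Vec ℕ N)
comps zero    zero    = [] ∷ []
comps zero    (suc n) = []
comps (suc N) n = concatMap (λ j → map (j ∷_) (comps N (n ∸ j))) (upTo (ℕ.suc n))

termProd : {N : ℕ} → Vec ℕ N → ℚ
termProd []       = 1ℚ
termProd (j ∷ js) = (recipℕ ((2 ℕ.* j) !) {{(2 ℕ.* j) !≢0}} * B (2 ℕ.* j)) * termProd js

S : (N n : ℕ) → ℚ
S N n = sumℚ (map (λ js → ℕtoℚ ((2 ℕ.* n) !) * termProd js) (comps N n))

-- Polynomials in the indeterminate β over ℚ, as coefficient lists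
-- (lowest degree first): [c_0, c_1, …] represents Σ c_j β^j.

Poly : Set
Poly = List ℚ

addP : Poly → Poly → Poly
addP []       q        = q
addP (a ∷ p)  []       = a ∷ p
addP (a ∷ p)  (b ∷ q)  = (a + b) ∷ addP p q

scaleP : ℚ → Poly → Poly
scaleP c = map (c *_)

mulP : Poly → Poly → Poly
mulP []       q = []
mulP (a ∷ p)  q = addP (scaleP a q) (0ℚ ∷ mulP p q)

shiftP : ℕ → Poly → Poly
shiftP k p = replicate k 0ℚ ++ p

sumP : List Poly → Poly
sumP = foldr addP []

βP : Poly
βP = 0ℚ ∷ 1ℚ ∷ []

constP : ℚ → Poly
constP c = c ∷ []

pochℚ : ℚ → ℕ → ℚ
pochℚ a zero    = 1ℚ
pochℚ a (suc l) = pochℚ a l * (a + ℕtoℚ l)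

pochP : Poly → ℕ → Poly
pochP p zero    = constP 1ℚ
pochP p (suc l) = mulP (pochP p l) (addP p (constP (ℕtoℚ l)))

pochℕ : ℕ → ℕ → ℕ
pochℕ c zero    = 1
pochℕ c (suc l) = pochℕ c l ℕ.* (c ℕ.+ l)

pochℕ-suc≢0 : ∀ c l → NonZero (pochℕ (suc c) l)
pochℕ-suc≢0 c zero    = _
pochℕ-suc≢0 c (suc l) = m*n≢0 (pochℕ (suc c) l) (suc c ℕ.+ l) {{pochℕ-suc≢0 c l}}

-- ℓ-th term of 2F1(a, b; c | x), with a, x ∈ ℚ, b a polynomial in β,
-- and c = suc c' a positive integer:  (a)_ℓ (b)_ℓ x^ℓ / ((c)_ℓ ℓ!)
hypTerm : ℚ → Poly → ℕ → ℚ → ℕ → Poly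
hypTerm a b c' x l =
  scaleP (pochℚ a l * powℚ x l *
          recipℕ (pochℕ (suc c') l ℕ.* (l !))
                 {{m*n≢0 (pochℕ (suc c') l) (l !) {{pochℕ-suc≢0 c' l}} {{l !≢0}}}})
         (pochP b l)

-- 2F1(a, b; suc c' | x) summed over ℓ = 0, …, L-1.  When a = 1 - N with
-- N ≥ 1, all terms with ℓ ≥ N vanish (since (1-N)_ℓ = 0), so taking L = N
-- gives the full (terminating) hypergeometric series.
hyp2F1 : (a : ℚ) (b : Poly) (c' : ℕ) (x : ℚ) (L : ℕ) → Poly
hyp2F1 a b c' x L = sumP (map (hypTerm a b c' x) (upTo L))

-- Umbral evaluation: replace each monomial β^j by B_j / j.
-- (j = 0 never occurs in the statement; it is sent to 0 for totality.)

umbralCoeff : ℕ → ℚ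
umbralCoeff zero    = 0ℚ
umbralCoeff (suc j) = B (suc j) * recipℕ (suc j)

umbral : Poly → ℚ
umbral p = sumℚ (zipWith (λ j c → c * umbralCoeff j) (upTo (Data.List.length p)) p)
  where import Data.List

rhsPoly : (N n : ℕ) → Poly
rhsPoly N n =
  scaleP ((ℤ.+ ((2 ℕ.* n) !) // ((2 ℕ.* n ∸ N) !)) {{(2 ℕ.* n ∸ N) !≢0}}
          * recipℕ (2 ℕ.^ (N ∸ 1)) {{m^n≢0 2 (N ∸ 1)}}
          * ℕtoℚ N)
    (shiftP (2 ℕ.* n ∸ N ℕ.+ 1)
      (hyp2F1 (1ℚ + - ℕtoℚ N) (addP (constP 1ℚ) βP) 1 (ℕtoℚ 2) N))

module Submission where

-- Let g(w) = Σ B_{2j} w^j/(2j)!, so that g(z²) = z/(e^z − 1) + z/2 = (z/2) coth (z/2) and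
-- S_N(n) = (2n)! [w^n] g^N. The Bernoulli recurrence says that z/(e^z − 1) is the inverse of
-- (e^z − 1)/z, which gives it a Riccati equation; the same equation makes the odd coefficients
-- of (z/2) coth (z/2) vanish, and in terms of g it reads g² = g − 2θg + w/4 with θ = w d/dw.
-- Together with θ(g^(M+1)) = (M+1) θg g^M this yields, whenever 2n = M + 2 + t,
--   (M+1) [w^n] g^(M+2) = −(t+1) [w^n] g^(M+1) + (M+1)/4 [w^(n−1)] g^M.
-- The right-hand side divided by (2n)! obeys the same recurrence: F_N = ₂F₁(1 − N, 1 + β; 2 | 2)
-- satisfies the contiguous relation (N+2) F_(N+2) = −2β F_(N+1) + N F_N, which is linear in the
-- coefficients and so survives the umbral map. The cases N = 0 and N = 1 are checked directly.

open import Defs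

module BernoulliConvolutionIdentity where
  open import Data.Nat as ℕ using (ℕ; zero; suc; _∸_; _!; _<_; _≤_; z≤n; s≤s; _^_; NonZero)
  import Data.Nat.Properties as ℕP
  open import Data.Nat.Properties using (_!≢0; m*n≢0; m^n≢0)
  open import Data.Nat.Combinatorics using (_C_; nCk≡nC[n∸k]; nC1≡n; k![n∸k]!∣n!)
  open import Data.Nat.Combinatorics.Specification using (nCk≡n!/k![n-k]!)
  open import Data.Nat.DivMod using (m/n*n≡m)
  open import Data.Nat.Induction using (<-rec)
  import Data.Nat.Solver as ℕSolver
  import Data.Nat.Coprimality as Coprime
  open import Data.Integer as ℤ using (ℤ)
  import Data.Integer.Properties as ℤP
  open import Data.Rational using (ℚ; mkℚ; 0ℚ; 1ℚ; ½; _+_; _*_; -_) renaming (_/_ to _//_)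
  import Data.Rational.Properties as ℚP
  open import Data.Rational.Solver using (module +-*-Solver)
  open import Data.List using (List; []; _∷_; _++_; [_]; map; concatMap; applyUpTo; upTo; zipWith; length)
  import Data.List.Properties as ListP
  open import Data.Vec using (Vec)
  open import Data.Product using (_,_; ∃-syntax)
  open import Data.Sum using (_⊎_; inj₁; inj₂)
  open import Function using (_∘_; id)
  open import Relation.Binary.PropositionalEquality hiding ([_])
  import Relation.Binary.Reasoning.Setoid as SetoidReasoning

  open +-*-Solver

  ℕtoℚ≡mkℚ : ∀ a → ℕtoℚ a ≡ mkℚ (ℤ.+ a) 0 (Coprime.sym (Coprime.1-coprimeTo a))
  ℕtoℚ≡mkℚ a = ℚP.normalize-coprime (Coprime.sym (Coprime.1-coprimeTo a))

  recipℕ≡mkℚ : ∀ d → recipℕ (suc d) ≡ mkℚ (ℤ.+ 1) d (Coprime.1-coprimeTo (suc d))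
  recipℕ≡mkℚ d = ℚP.normalize-coprime (Coprime.1-coprimeTo (suc d))

  ℕtoℚ-+ : ∀ a b → ℕtoℚ (a ℕ.+ b) ≡ ℕtoℚ a + ℕtoℚ b
  ℕtoℚ-+ a b rewrite ℕtoℚ≡mkℚ a | ℕtoℚ≡mkℚ b =
    ℚP./-cong {p₁ = ℤ.+ (a ℕ.+ b)} {q₁ = 1} {p₂ = ℤ.+ a ℤ.* ℤ.+ 1 ℤ.+ ℤ.+ b ℤ.* ℤ.+ 1} {q₂ = 1}
      (trans (ℤP.pos-+ a b) (sym (cong₂ ℤ._+_ (ℤP.*-identityʳ (ℤ.+ a)) (ℤP.*-identityʳ (ℤ.+ b))))) refl

  ℕtoℚ-* : ∀ a b → ℕtoℚ (a ℕ.* b) ≡ ℕtoℚ a * ℕtoℚ b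
  ℕtoℚ-* a b rewrite ℕtoℚ≡mkℚ a | ℕtoℚ≡mkℚ b =
    ℚP./-cong {p₁ = ℤ.+ (a ℕ.* b)} {q₁ = 1} {p₂ = ℤ.+ a ℤ.* ℤ.+ b} {q₂ = 1} (ℤP.pos-* a b) refl

  ℕtoℚ-suc : ∀ a → ℕtoℚ (suc a) ≡ 1ℚ + ℕtoℚ a
  ℕtoℚ-suc = ℕtoℚ-+ 1

  ℕtoℚ-2+ : ∀ m → ℕtoℚ (2 ℕ.+ m) ≡ 1ℚ + (1ℚ + ℕtoℚ m)
  ℕtoℚ-2+ m = trans (ℕtoℚ-suc (suc m)) (cong (1ℚ +_) (ℕtoℚ-suc m))

  recipℕ-inverseˡ : ∀ d .{{_ : NonZero d}} → recipℕ d * ℕtoℚ d ≡ 1ℚ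
  recipℕ-inverseˡ (suc d) = trans (cong₂ _*_ (recipℕ≡mkℚ d) (ℕtoℚ≡mkℚ (suc d)))
    (ℚP.*-inverseˡ (mkℚ (ℤ.+ suc d) 0 (Coprime.sym (Coprime.1-coprimeTo (suc d)))))

  recipℕ-inverseʳ : ∀ d .{{_ : NonZero d}} → ℕtoℚ d * recipℕ d ≡ 1ℚ
  recipℕ-inverseʳ d = trans (ℚP.*-comm (ℕtoℚ d) (recipℕ d)) (recipℕ-inverseˡ d)

  recipℕ-* : ∀ a b .{{_ : NonZero a}} .{{_ : NonZero b}} .{{_ : NonZero (a ℕ.* b)}} →
    recipℕ (a ℕ.* b) ≡ recipℕ a * recipℕ b
  recipℕ-* (suc a) (suc b) rewrite recipℕ≡mkℚ a | recipℕ≡mkℚ b =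
    ℚP./-cong {p₁ = ℤ.+ 1} {q₁ = suc a ℕ.* suc b} {p₂ = ℤ.+ 1 ℤ.* ℤ.+ 1} {q₂ = suc a ℕ.* suc b} refl refl

  //≡ℕtoℚ*recipℕ : ∀ a d .{{_ : NonZero d}} → (ℤ.+ a) // d ≡ ℕtoℚ a * recipℕ d
  //≡ℕtoℚ*recipℕ a (suc d) rewrite recipℕ≡mkℚ d | ℕtoℚ≡mkℚ a =
    ℚP./-cong {p₁ = ℤ.+ a} {q₁ = suc d} {p₂ = ℤ.+ a ℤ.* ℤ.+ 1} {q₂ = 1 ℕ.* suc d}
      (sym (ℤP.*-identityʳ (ℤ.+ a))) (sym (ℕP.*-identityˡ (suc d)))

  *-cancelˡ-ℕtoℚ : ∀ d .{{_ : NonZero d}} {x y : ℚ} → ℕtoℚ d * x ≡ ℕtoℚ d * y → x ≡ y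
  *-cancelˡ-ℕtoℚ d {x} {y} eq = begin
    x                         ≡⟨ sym (ℚP.*-identityˡ x) ⟩
    1ℚ * x                    ≡⟨ cong (_* x) (sym (recipℕ-inverseˡ d)) ⟩
    recipℕ d * ℕtoℚ d * x     ≡⟨ ℚP.*-assoc (recipℕ d) _ x ⟩
    recipℕ d * (ℕtoℚ d * x)   ≡⟨ cong (recipℕ d *_) eq ⟩
    recipℕ d * (ℕtoℚ d * y)   ≡⟨ sym (ℚP.*-assoc (recipℕ d) _ y) ⟩
    recipℕ d * ℕtoℚ d * y     ≡⟨ cong (_* y) (recipℕ-inverseˡ d) ⟩
    1ℚ * y                    ≡⟨ ℚP.*-identityˡ y ⟩
    y                         ∎
    where open ≡-Reasoning

  ℕtoℚ-exact-quotient : ∀ a d b .{{_ : NonZero d}} → a ℕ.* d ≡ b → ℕtoℚ a ≡ ℕtoℚ b * recipℕ d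
  ℕtoℚ-exact-quotient a d b eq = begin
    ℕtoℚ a                          ≡⟨ sym (ℚP.*-identityʳ (ℕtoℚ a)) ⟩
    ℕtoℚ a * 1ℚ                     ≡⟨ cong (ℕtoℚ a *_) (sym (recipℕ-inverseʳ d)) ⟩
    ℕtoℚ a * (ℕtoℚ d * recipℕ d)    ≡⟨ sym (ℚP.*-assoc (ℕtoℚ a) (ℕtoℚ d) (recipℕ d)) ⟩
    ℕtoℚ a * ℕtoℚ d * recipℕ d      ≡⟨ cong (_* recipℕ d) (sym (ℕtoℚ-* a d)) ⟩
    ℕtoℚ (a ℕ.* d) * recipℕ d       ≡⟨ cong (λ x → ℕtoℚ x * recipℕ d) eq ⟩
    ℕtoℚ b * recipℕ d               ∎
    where open ≡-Reasoning

  recipℕ-exact-divisor : ∀ a q b .{{_ : NonZero a}} .{{_ : NonZero b}} → a ℕ.* q ≡ b →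
    recipℕ a ≡ recipℕ b * ℕtoℚ q
  recipℕ-exact-divisor a q b eq = begin
    recipℕ a                                    ≡⟨ sym (ℚP.*-identityʳ (recipℕ a)) ⟩
    recipℕ a * 1ℚ                               ≡⟨ cong (recipℕ a *_) (sym (recipℕ-inverseˡ b)) ⟩
    recipℕ a * (recipℕ b * ℕtoℚ b)              ≡⟨ cong (λ t → recipℕ a * (recipℕ b * t)) (trans (cong ℕtoℚ (sym eq)) (ℕtoℚ-* a q)) ⟩
    recipℕ a * (recipℕ b * (ℕtoℚ a * ℕtoℚ q))   ≡⟨ solve 4 (λ ra rb A Q → ra :* (rb :* (A :* Q)) := rb :* Q :* (ra :* A)) refl (recipℕ a) (recipℕ b) (ℕtoℚ a) (ℕtoℚ q) ⟩
    recipℕ b * ℕtoℚ q * (recipℕ a * ℕtoℚ a)     ≡⟨ cong (recipℕ b * ℕtoℚ q *_) (recipℕ-inverseˡ a) ⟩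
    recipℕ b * ℕtoℚ q * 1ℚ                      ≡⟨ ℚP.*-identityʳ (recipℕ b * ℕtoℚ q) ⟩
    recipℕ b * ℕtoℚ q                           ∎
    where open ≡-Reasoning

  recipℕ-2^≡½^ : ∀ k → recipℕ (2 ^ k) {{m^n≢0 2 k}} ≡ powℚ ½ k
  recipℕ-2^≡½^ zero    = refl
  recipℕ-2^≡½^ (suc k) = begin
    recipℕ (2 ℕ.* 2 ^ k) {{m^n≢0 2 (suc k)}}        ≡⟨ recipℕ-* 2 (2 ^ k) {{_}} {{m^n≢0 2 k}} {{m^n≢0 2 (suc k)}} ⟩
    ½ * recipℕ (2 ^ k) {{m^n≢0 2 k}}                ≡⟨ cong (½ *_) (recipℕ-2^≡½^ k) ⟩
    ½ * powℚ ½ k                                    ≡⟨ ℚP.*-comm ½ (powℚ ½ k) ⟩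
    powℚ ½ k * ½                                    ∎
    where open ≡-Reasoning

  invFact : ℕ → ℚ
  invFact k = recipℕ (k !) {{k !≢0}}

  invFact-suc : ∀ n → invFact n ≡ invFact (suc n) * ℕtoℚ (suc n)
  invFact-suc n = recipℕ-exact-divisor (n !) (suc n) (suc n !) {{n !≢0}} {{suc n !≢0}} (ℕP.*-comm (n !) (suc n))

  binomial≡factorials : ∀ n k → k ≤ n → ℕtoℚ (n C k) ≡ ℕtoℚ (n !) * (invFact k * invFact (n ∸ k))
  binomial≡factorials n k k≤n =
    trans (ℕtoℚ-exact-quotient (n C k) (k ! ℕ.* (n ∸ k) !) (n !) {{k!*[n∸k]!≢0}} n!-split)
          (cong (ℕtoℚ (n !) *_) (recipℕ-* (k !) ((n ∸ k) !) {{k !≢0}} {{(n ∸ k) !≢0}} {{k!*[n∸k]!≢0}}))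
    where
    k!*[n∸k]!≢0 = m*n≢0 (k !) ((n ∸ k) !) {{k !≢0}} {{(n ∸ k) !≢0}}
    n!-split : (n C k) ℕ.* (k ! ℕ.* (n ∸ k) !) ≡ n !
    n!-split = trans (cong (ℕ._* (k ! ℕ.* (n ∸ k) !)) (nCk≡n!/k![n-k]! {n} {k} k≤n))
                     (m/n*n≡m {{k!*[n∸k]!≢0}} (k![n∸k]!∣n! k≤n))

  -- Finite sums

  Σ : ℕ → (ℕ → ℚ) → ℚ
  Σ zero    f = 0ℚ
  Σ (suc n) f = f 0 + Σ n (f ∘ suc)

  Σ-cong : ∀ n {f g : ℕ → ℚ} → (∀ i → i < n → f i ≡ g i) → Σ n f ≡ Σ n g
  Σ-cong zero    eq = refl
  Σ-cong (suc n) eq = cong₂ _+_ (eq 0 (s≤s z≤n)) (Σ-cong n (λ i i<n → eq (suc i) (s≤s i<n)))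

  Σ-cong′ : ∀ n {f g : ℕ → ℚ} → f ≗ g → Σ n f ≡ Σ n g
  Σ-cong′ n eq = Σ-cong n (λ i _ → eq i)

  sumℚ-applyUpTo : ∀ n (f : ℕ → ℚ) → sumℚ (applyUpTo f n) ≡ Σ n f
  sumℚ-applyUpTo zero    f = refl
  sumℚ-applyUpTo (suc n) f = cong (f 0 +_) (sumℚ-applyUpTo n (f ∘ suc))

  Σ-zero : ∀ n {f : ℕ → ℚ} → (∀ i → i < n → f i ≡ 0ℚ) → Σ n f ≡ 0ℚ
  Σ-zero zero    eq = refl
  Σ-zero (suc n) eq = trans (cong₂ _+_ (eq 0 (s≤s z≤n)) (Σ-zero n (λ i i<n → eq (suc i) (s≤s i<n))))
                            (ℚP.+-identityˡ 0ℚ)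

  Σ-+ : ∀ n (f g : ℕ → ℚ) → Σ n (λ i → f i + g i) ≡ Σ n f + Σ n g
  Σ-+ zero    f g = refl
  Σ-+ (suc n) f g rewrite Σ-+ n (f ∘ suc) (g ∘ suc) =
    solve 4 (λ a b c d → (a :+ b) :+ (c :+ d) := (a :+ c) :+ (b :+ d)) refl
      (f 0) (g 0) (Σ n (f ∘ suc)) (Σ n (g ∘ suc))

  Σ-*ˡ : ∀ n (c : ℚ) (f : ℕ → ℚ) → c * Σ n f ≡ Σ n (λ i → c * f i)
  Σ-*ˡ zero    c f = ℚP.*-zeroʳ c
  Σ-*ˡ (suc n) c f = trans (ℚP.*-distribˡ-+ c (f 0) _) (cong (c * f 0 +_) (Σ-*ˡ n c (f ∘ suc)))

  Σ-*ʳ : ∀ n (c : ℚ) (f : ℕ → ℚ) → Σ n f * c ≡ Σ n (λ i → f i * c)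
  Σ-*ʳ n c f = trans (ℚP.*-comm _ c) (trans (Σ-*ˡ n c f) (Σ-cong′ n (λ i → ℚP.*-comm c (f i))))

  Σ-last : ∀ n (f : ℕ → ℚ) → Σ (suc n) f ≡ Σ n f + f n
  Σ-last zero    f = trans (ℚP.+-identityʳ (f 0)) (sym (ℚP.+-identityˡ (f 0)))
  Σ-last (suc n) f rewrite Σ-last n (f ∘ suc) = sym (ℚP.+-assoc (f 0) _ _)

  Σ-split : ∀ a b (f : ℕ → ℚ) → Σ (a ℕ.+ b) f ≡ Σ a f + Σ b (λ i → f (a ℕ.+ i))
  Σ-split zero    b f = sym (ℚP.+-identityˡ _)
  Σ-split (suc a) b f rewrite Σ-split a b (f ∘ suc) = sym (ℚP.+-assoc (f 0) _ _)

  Σ-vanishing-tail : ∀ a b (f : ℕ → ℚ) → (∀ k → a ≤ k → f k ≡ 0ℚ) → a ≤ b → Σ b f ≡ Σ a f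
  Σ-vanishing-tail a b f tail a≤b = begin
    Σ b f                                     ≡⟨ cong (λ m → Σ m f) (sym (ℕP.m+[n∸m]≡n a≤b)) ⟩
    Σ (a ℕ.+ (b ∸ a)) f                       ≡⟨ Σ-split a (b ∸ a) f ⟩
    Σ a f + Σ (b ∸ a) (λ i → f (a ℕ.+ i))     ≡⟨ cong (Σ a f +_) (Σ-zero (b ∸ a) (λ i _ → tail (a ℕ.+ i) (ℕP.m≤m+n a i))) ⟩
    Σ a f + 0ℚ                                ≡⟨ ℚP.+-identityʳ (Σ a f) ⟩
    Σ a f                                     ∎
    where open ≡-Reasoning

  Σ-reverse : ∀ n (f : ℕ → ℚ) → Σ n f ≡ Σ n (λ i → f (n ∸ suc i))
  Σ-reverse zero    f = refl
  Σ-reverse (suc n) f = begin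
    f 0 + Σ n (f ∘ suc)                         ≡⟨ cong (f 0 +_) (Σ-reverse n (f ∘ suc)) ⟩
    f 0 + Σ n (λ i → f (suc (n ∸ suc i)))       ≡⟨ ℚP.+-comm (f 0) _ ⟩
    Σ n (λ i → f (suc (n ∸ suc i))) + f 0       ≡⟨ cong₂ _+_ (Σ-cong n (λ i i<n → cong f (sym (ℕP.+-∸-assoc 1 i<n)))) (cong f (sym (ℕP.n∸n≡0 n))) ⟩
    Σ n (λ i → f (n ∸ i)) + f (n ∸ n)           ≡⟨ sym (Σ-last n (λ i → f (n ∸ i))) ⟩
    Σ (suc n) (λ i → f (n ∸ i))                 ∎
    where open ≡-Reasoning

  Σ-triangle : ∀ n (F : ℕ → ℕ → ℚ) →
    Σ n (λ i → Σ (suc i) (F i)) ≡ Σ n (λ j → Σ (n ∸ j) (λ k → F (j ℕ.+ k) j))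
  Σ-triangle zero    F = refl
  Σ-triangle (suc n) F = begin
    Σ (suc n) (λ i → Σ (suc i) (F i))                   ≡⟨ Σ-last n _ ⟩
    Σ n (λ i → Σ (suc i) (F i)) + Σ (suc n) (F n)       ≡⟨ cong (_+ Σ (suc n) (F n)) (Σ-triangle n F) ⟩
    Σ n column + Σ (suc n) (F n)                        ≡⟨ cong (_+ Σ (suc n) (F n)) (sym column-last) ⟩
    Σ (suc n) column + Σ (suc n) (F n)                  ≡⟨ sym (Σ-+ (suc n) column (F n)) ⟩
    Σ (suc n) (λ j → column j + F n j)                  ≡⟨ Σ-cong (suc n) extend-column ⟩
    Σ (suc n) (λ j → Σ (suc n ∸ j) (λ k → F (j ℕ.+ k) j)) ∎
    where
    open ≡-Reasoning
    column : ℕ → ℚ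
    column j = Σ (n ∸ j) (λ k → F (j ℕ.+ k) j)
    column-last : Σ (suc n) column ≡ Σ n column
    column-last = trans (Σ-last n column)
      (trans (cong (λ m → Σ n column + Σ m (λ k → F (n ℕ.+ k) n)) (ℕP.n∸n≡0 n)) (ℚP.+-identityʳ (Σ n column)))
    extend-column : ∀ j → j < suc n → column j + F n j ≡ Σ (suc n ∸ j) (λ k → F (j ℕ.+ k) j)
    extend-column j (s≤s j≤n) rewrite ℕP.+-∸-assoc 1 j≤n =
      sym (trans (Σ-last (n ∸ j) _) (cong (λ m → column j + F m j) (ℕP.m+[n∸m]≡n j≤n)))

  even⊎odd : ∀ j → (∃[ s ] j ≡ 2 ℕ.* s) ⊎ (∃[ s ] j ≡ suc (2 ℕ.* s))
  even⊎odd zero = inj₁ (0 , refl)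
  even⊎odd (suc j) with even⊎odd j
  ... | inj₁ (s , j≡2s)   = inj₂ (s , cong suc j≡2s)
  ... | inj₂ (s , j≡2s+1) = inj₁ (suc s , trans (cong suc j≡2s+1) (sym (ℕP.*-suc 2 s)))

  Σ-even-odd : ∀ n (F : ℕ → ℚ) → Σ (suc (2 ℕ.* n)) F ≡ Σ (suc n) (λ j → F (2 ℕ.* j)) + Σ n (λ j → F (suc (2 ℕ.* j)))
  Σ-even-odd zero    F = sym (ℚP.+-identityʳ (F 0 + 0ℚ))
  Σ-even-odd (suc n) F = begin
    Σ (suc (2 ℕ.* suc n)) F                               ≡⟨ cong (λ k → Σ (suc k) F) (ℕP.*-suc 2 n) ⟩
    Σ (3 ℕ.+ 2 ℕ.* n) F                                   ≡⟨ Σ-last (2 ℕ.+ 2 ℕ.* n) F ⟩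
    Σ (2 ℕ.+ 2 ℕ.* n) F + F (2 ℕ.+ 2 ℕ.* n)               ≡⟨ cong (_+ F (2 ℕ.+ 2 ℕ.* n)) (Σ-last (suc (2 ℕ.* n)) F) ⟩
    Σ (suc (2 ℕ.* n)) F + F (suc (2 ℕ.* n)) + F (2 ℕ.+ 2 ℕ.* n)
      ≡⟨ cong (λ t → t + F (suc (2 ℕ.* n)) + F (2 ℕ.+ 2 ℕ.* n)) (Σ-even-odd n F) ⟩
    Ev + Od + F (suc (2 ℕ.* n)) + F (2 ℕ.+ 2 ℕ.* n)
      ≡⟨ solve 4 (λ a b c d → a :+ b :+ c :+ d := (a :+ d) :+ (b :+ c)) refl Ev Od (F (suc (2 ℕ.* n))) (F (2 ℕ.+ 2 ℕ.* n)) ⟩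
    (Ev + F (2 ℕ.+ 2 ℕ.* n)) + (Od + F (suc (2 ℕ.* n)))
      ≡⟨ cong₂ _+_ (trans (cong (λ k → Ev + F k) (sym (ℕP.*-suc 2 n))) (sym (Σ-last (suc n) (λ j → F (2 ℕ.* j)))))
                   (sym (Σ-last n (λ j → F (suc (2 ℕ.* j))))) ⟩
    Σ (2 ℕ.+ n) (λ j → F (2 ℕ.* j)) + Σ (suc n) (λ j → F (suc (2 ℕ.* j))) ∎
    where
    open ≡-Reasoning
    Ev = Σ (suc n) (λ j → F (2 ℕ.* j))
    Od = Σ n (λ j → F (suc (2 ℕ.* j)))

  -- Formal power series as coefficient sequences: shift multiplies by z, θ is the Euler operator z d/dz

  Series : Set
  Series = ℕ → ℚ

  module ≗-Reasoning = SetoidReasoning (ℕ →-setoid ℚ)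

  infixl 7 _⋆_
  infixl 6 _⊕_

  _⋆_ : Series → Series → Series
  (a ⋆ b) n = Σ (suc n) (λ j → a j * b (n ∸ j))

  _⊕_ : Series → Series → Series
  (a ⊕ b) n = a n + b n

  scale : ℚ → Series → Series
  scale c a n = c * a n

  0ˢ : Series
  0ˢ _ = 0ℚ

  one : Series
  one zero    = 1ℚ
  one (suc n) = 0ℚ

  shift : Series → Series
  shift a zero    = 0ℚ
  shift a (suc n) = a n

  θ : Series → Series
  θ a n = ℕtoℚ n * a n

  ⊕-cong : ∀ {a a′ b b′} → a ≗ a′ → b ≗ b′ → a ⊕ b ≗ a′ ⊕ b′
  ⊕-cong p q n = cong₂ _+_ (p n) (q n)

  scale-cong : ∀ c {a a′} → a ≗ a′ → scale c a ≗ scale c a′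
  scale-cong c p n = cong (c *_) (p n)

  shift-cong : ∀ {a a′} → a ≗ a′ → shift a ≗ shift a′
  shift-cong p zero    = refl
  shift-cong p (suc n) = p n

  ⋆-cong : ∀ {a a′ b b′} → a ≗ a′ → b ≗ b′ → a ⋆ b ≗ a′ ⋆ b′
  ⋆-cong p q n = Σ-cong′ (suc n) (λ j → cong₂ _*_ (p j) (q (n ∸ j)))

  ⋆-congˡ : ∀ {a a′} b → a ≗ a′ → a ⋆ b ≗ a′ ⋆ b
  ⋆-congˡ b p = ⋆-cong {b = b} {b} p (λ _ → refl)

  ⋆-congʳ : ∀ a {b b′} → b ≗ b′ → a ⋆ b ≗ a ⋆ b′
  ⋆-congʳ a q = ⋆-cong {a} {a} (λ _ → refl) q

  ⋆-comm : ∀ a b → a ⋆ b ≗ b ⋆ a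
  ⋆-comm a b n = begin
    Σ (suc n) (λ j → a j * b (n ∸ j))               ≡⟨ Σ-reverse (suc n) (λ j → a j * b (n ∸ j)) ⟩
    Σ (suc n) (λ i → a (n ∸ i) * b (n ∸ (n ∸ i)))   ≡⟨ Σ-cong (suc n) swap ⟩
    Σ (suc n) (λ i → b i * a (n ∸ i))               ∎
    where
    open ≡-Reasoning
    swap : ∀ i → i < suc n → a (n ∸ i) * b (n ∸ (n ∸ i)) ≡ b i * a (n ∸ i)
    swap i (s≤s i≤n) = trans (ℚP.*-comm (a (n ∸ i)) _) (cong (λ m → b m * a (n ∸ i)) (ℕP.m∸[m∸n]≡n i≤n))

  ⋆-assoc : ∀ a b c → (a ⋆ b) ⋆ c ≗ a ⋆ (b ⋆ c)
  ⋆-assoc a b c n = begin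
    Σ (suc n) (λ i → Σ (suc i) (λ j → a j * b (i ∸ j)) * c (n ∸ i))
      ≡⟨ Σ-cong′ (suc n) (λ i → Σ-*ʳ (suc i) (c (n ∸ i)) (λ j → a j * b (i ∸ j))) ⟩
    Σ (suc n) (λ i → Σ (suc i) (λ j → a j * b (i ∸ j) * c (n ∸ i)))
      ≡⟨ Σ-triangle (suc n) (λ i j → a j * b (i ∸ j) * c (n ∸ i)) ⟩
    Σ (suc n) (λ j → Σ (suc n ∸ j) (λ k → a j * b ((j ℕ.+ k) ∸ j) * c (n ∸ (j ℕ.+ k))))
      ≡⟨ Σ-cong (suc n) regroup ⟩
    Σ (suc n) (λ j → a j * Σ (suc (n ∸ j)) (λ k → b k * c ((n ∸ j) ∸ k))) ∎
    where
    open ≡-Reasoning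
    regroup : ∀ j → j < suc n → Σ (suc n ∸ j) (λ k → a j * b ((j ℕ.+ k) ∸ j) * c (n ∸ (j ℕ.+ k)))
                                ≡ a j * Σ (suc (n ∸ j)) (λ k → b k * c ((n ∸ j) ∸ k))
    regroup j (s≤s j≤n) rewrite ℕP.+-∸-assoc 1 j≤n =
      sym (trans (Σ-*ˡ (suc (n ∸ j)) (a j) (λ k → b k * c ((n ∸ j) ∸ k)))
        (Σ-cong′ (suc (n ∸ j)) (λ k → trans (sym (ℚP.*-assoc (a j) (b k) (c ((n ∸ j) ∸ k))))
          (cong₂ (λ u v → a j * b u * c v) (sym (ℕP.m+n∸m≡n j k)) (ℕP.∸-+-assoc n j k)))))

  ⋆-distribʳ-⊕ : ∀ a b c → (a ⊕ b) ⋆ c ≗ a ⋆ c ⊕ b ⋆ c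
  ⋆-distribʳ-⊕ a b c n =
    trans (Σ-cong′ (suc n) (λ j → ℚP.*-distribʳ-+ (c (n ∸ j)) (a j) (b j)))
          (Σ-+ (suc n) (λ j → a j * c (n ∸ j)) (λ j → b j * c (n ∸ j)))

  scale-⋆ : ∀ k a b → scale k a ⋆ b ≗ scale k (a ⋆ b)
  scale-⋆ k a b n =
    trans (Σ-cong′ (suc n) (λ j → ℚP.*-assoc k (a j) (b (n ∸ j))))
          (sym (Σ-*ˡ (suc n) k (λ j → a j * b (n ∸ j))))

  ⋆-scale : ∀ k a b → a ⋆ scale k b ≗ scale k (a ⋆ b)
  ⋆-scale k a b n = trans (⋆-comm a (scale k b) n) (trans (scale-⋆ k b a n) (cong (k *_) (⋆-comm b a n)))

  ⋆-identityˡ : ∀ b → one ⋆ b ≗ b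
  ⋆-identityˡ b n = trans (cong₂ _+_ (ℚP.*-identityˡ (b n))
    (Σ-zero n (λ i _ → ℚP.*-zeroˡ (b (n ∸ suc i))))) (ℚP.+-identityʳ (b n))

  ⋆-identityʳ : ∀ a → a ⋆ one ≗ a
  ⋆-identityʳ a n = trans (⋆-comm a one n) (⋆-identityˡ a n)

  shift-⋆ : ∀ a b → shift a ⋆ b ≗ shift (a ⋆ b)
  shift-⋆ a b zero    = trans (ℚP.+-identityʳ (0ℚ * b 0)) (ℚP.*-zeroˡ (b 0))
  shift-⋆ a b (suc n) = trans (cong (_+ (a ⋆ b) n) (ℚP.*-zeroˡ (b (suc n)))) (ℚP.+-identityˡ ((a ⋆ b) n))

  θ-one : θ one ≗ 0ˢ
  θ-one zero    = refl
  θ-one (suc n) = ℚP.*-zeroʳ (ℕtoℚ (suc n))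

  θ-⋆ : ∀ a b → θ (a ⋆ b) ≗ θ a ⋆ b ⊕ a ⋆ θ b
  θ-⋆ a b n = begin
    ℕtoℚ n * Σ (suc n) (λ j → a j * b (n ∸ j))    ≡⟨ Σ-*ˡ (suc n) (ℕtoℚ n) (λ j → a j * b (n ∸ j)) ⟩
    Σ (suc n) (λ j → ℕtoℚ n * (a j * b (n ∸ j)))  ≡⟨ Σ-cong (suc n) leibniz ⟩
    Σ (suc n) (λ j → ℕtoℚ j * a j * b (n ∸ j) + a j * (ℕtoℚ (n ∸ j) * b (n ∸ j)))
      ≡⟨ Σ-+ (suc n) (λ j → ℕtoℚ j * a j * b (n ∸ j)) (λ j → a j * (ℕtoℚ (n ∸ j) * b (n ∸ j))) ⟩
    (θ a ⋆ b) n + (a ⋆ θ b) n                    ∎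
    where
    open ≡-Reasoning
    leibniz : ∀ j → j < suc n → ℕtoℚ n * (a j * b (n ∸ j)) ≡ ℕtoℚ j * a j * b (n ∸ j) + a j * (ℕtoℚ (n ∸ j) * b (n ∸ j))
    leibniz j (s≤s j≤n) = trans (cong (λ m → ℕtoℚ m * (a j * b (n ∸ j))) (sym (ℕP.m+[n∸m]≡n j≤n)))
      (trans (cong (_* (a j * b (n ∸ j))) (ℕtoℚ-+ j (n ∸ j)))
        (solve 4 (λ x y u v → (x :+ y) :* (u :* v) := x :* u :* v :+ u :* (y :* v)) refl
          (ℕtoℚ j) (ℕtoℚ (n ∸ j)) (a j) (b (n ∸ j))))

  ⋆-cancelʳ : ∀ a e → e 0 ≡ 1ℚ → a ⋆ e ≗ 0ˢ → a ≗ 0ˢ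
  ⋆-cancelʳ a e e0≡1 a⋆e≡0 m = below (suc m) m ℕP.≤-refl
    where
    below : ∀ m j → j < m → a j ≡ 0ℚ
    below (suc m) j (s≤s j≤m) with ℕP.m≤n⇒m<n∨m≡n j≤m
    ... | inj₁ j<m  = below m j j<m
    ... | inj₂ refl = begin
      a j                                         ≡⟨ sym (ℚP.*-identityʳ (a j)) ⟩
      a j * 1ℚ                                    ≡⟨ cong (a j *_) (trans (sym e0≡1) (cong e (sym (ℕP.n∸n≡0 j)))) ⟩
      a j * e (j ∸ j)                             ≡⟨ sym (ℚP.+-identityˡ (a j * e (j ∸ j))) ⟩
      0ℚ + a j * e (j ∸ j)                        ≡⟨ cong (_+ a j * e (j ∸ j)) (sym (Σ-zero j earlier)) ⟩
      Σ j (λ i → a i * e (j ∸ i)) + a j * e (j ∸ j) ≡⟨ sym (Σ-last j (λ i → a i * e (j ∸ i))) ⟩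
      (a ⋆ e) j                                   ≡⟨ a⋆e≡0 j ⟩
      0ℚ                                          ∎
      where
      open ≡-Reasoning
      earlier : ∀ i → i < j → a i * e (j ∸ i) ≡ 0ℚ
      earlier i i<j = trans (cong (_* e (j ∸ i)) (below j i i<j)) (ℚP.*-zeroˡ (e (j ∸ i)))

  -- The Bernoulli generating function z/(e^z − 1) and its Riccati equation

  nth-∷ʳ : ∀ (xs : List ℚ) y → nth (xs ++ [ y ]) (length xs) ≡ y
  nth-∷ʳ []       y = refl
  nth-∷ʳ (x ∷ xs) y = nth-∷ʳ xs y

  length-bernList : ∀ m → length (bernList m) ≡ m
  length-bernList zero    = refl
  length-bernList (suc m) = trans (ListP.length-++ (bernList m))
                                  (trans (cong (ℕ._+ 1) (length-bernList m)) (ℕP.+-comm m 1))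

  B≡bernNext : ∀ m → B m ≡ bernNext m (bernList m)
  B≡bernNext m = subst (λ k → nth (bernList m ++ [ bernNext m (bernList m) ]) k ≡ bernNext m (bernList m))
                       (length-bernList m) (nth-∷ʳ (bernList m) (bernNext m (bernList m)))

  bernList≡applyUpTo : ∀ m → bernList m ≡ applyUpTo B m
  bernList≡applyUpTo zero    = refl
  bernList≡applyUpTo (suc m) = trans (cong₂ (λ xs y → xs ++ [ y ]) (bernList≡applyUpTo m) (sym (B≡bernNext m)))
                                     (ListP.applyUpTo-∷ʳ B m)

  zipWith-applyUpTo : ∀ (f : ℕ → ℚ → ℚ) (g : ℕ → ℕ) (h : ℕ → ℚ) n →
    zipWith f (applyUpTo g n) (applyUpTo h n) ≡ applyUpTo (λ k → f (g k) (h k)) n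
  zipWith-applyUpTo f g h zero    = refl
  zipWith-applyUpTo f g h (suc n) = cong (f (g 0) (h 0) ∷_) (zipWith-applyUpTo f (g ∘ suc) (h ∘ suc) n)

  B-suc : ∀ m → B (suc m) ≡ - (recipℕ (2 ℕ.+ m) * Σ (suc m) (λ k → ℕtoℚ ((2 ℕ.+ m) C k) * B k))
  B-suc m = begin
    B (suc m)                                     ≡⟨ B≡bernNext (suc m) ⟩
    - (recipℕ (2 ℕ.+ m) * sumℚ (zipWith term (upTo (suc m)) (bernList (suc m))))
      ≡⟨ cong (λ bs → - (recipℕ (2 ℕ.+ m) * sumℚ (zipWith term (upTo (suc m)) bs))) (bernList≡applyUpTo (suc m)) ⟩
    - (recipℕ (2 ℕ.+ m) * sumℚ (zipWith term (upTo (suc m)) (applyUpTo B (suc m))))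
      ≡⟨ cong (λ xs → - (recipℕ (2 ℕ.+ m) * sumℚ xs)) (zipWith-applyUpTo term id B (suc m)) ⟩
    - (recipℕ (2 ℕ.+ m) * sumℚ (applyUpTo (λ k → term k (B k)) (suc m)))
      ≡⟨ cong (λ x → - (recipℕ (2 ℕ.+ m) * x)) (sumℚ-applyUpTo (suc m) (λ k → term k (B k))) ⟩
    - (recipℕ (2 ℕ.+ m) * Σ (suc m) (λ k → ℕtoℚ ((2 ℕ.+ m) C k) * B k)) ∎
    where
    open ≡-Reasoning
    term : ℕ → ℚ → ℚ
    term k b = ℕtoℚ ((2 ℕ.+ m) C k) * b

  bernoulli-recurrence : ∀ m → Σ (2 ℕ.+ m) (λ k → ℕtoℚ ((2 ℕ.+ m) C k) * B k) ≡ 0ℚ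
  bernoulli-recurrence m = begin
    Σ (suc n) F                     ≡⟨ Σ-last n F ⟩
    X + F n                         ≡⟨ cong (λ c → X + ℕtoℚ c * B n) nCn-1≡n ⟩
    X + ℕtoℚ (suc n) * B n          ≡⟨ cong (λ b → X + ℕtoℚ (suc n) * b) (B-suc m) ⟩
    X + ℕtoℚ (suc n) * - (recipℕ (suc n) * X)
      ≡⟨ solve 3 (λ x a r → x :+ a :* (:- (r :* x)) := x :+ (:- (r :* a)) :* x) refl X (ℕtoℚ (suc n)) (recipℕ (suc n)) ⟩
    X + - (recipℕ (suc n) * ℕtoℚ (suc n)) * X  ≡⟨ cong (λ t → X + - t * X) (recipℕ-inverseˡ (suc n)) ⟩
    X + - 1ℚ * X                    ≡⟨ solve 1 (λ x → x :+ (:- con 1ℚ) :* x := con 0ℚ) refl X ⟩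
    0ℚ                              ∎
    where
    open ≡-Reasoning
    n = suc m
    F : ℕ → ℚ
    F k = ℕtoℚ (suc n C k) * B k
    X = Σ n F
    nCn-1≡n : suc n C n ≡ suc n
    nCn-1≡n = trans (nCk≡nC[n∸k] {n} {suc n} (ℕP.n≤1+n n))
                    (trans (cong (suc n C_) (ℕP.m+n∸n≡m 1 n)) (nC1≡n (suc n)))

  bernoulliGF : Series
  bernoulliGF m = invFact m * B m

  expm1/z : Series
  expm1/z m = invFact (suc m)

  bernoulliGF⋆expm1/z : bernoulliGF ⋆ expm1/z ≗ one
  bernoulliGF⋆expm1/z zero    = refl
  bernoulliGF⋆expm1/z (suc m) = *-cancelˡ-ℕtoℚ (n !) {{n !≢0}} (begin
    ℕtoℚ (n !) * (h ⋆ e) (suc m)     ≡⟨ Σ-*ˡ n (ℕtoℚ (n !)) (λ k → h k * e (suc m ∸ k)) ⟩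
    Σ n (λ k → ℕtoℚ (n !) * (h k * e (suc m ∸ k)))  ≡⟨ Σ-cong n binomial-term ⟩
    Σ n (λ k → ℕtoℚ (n C k) * B k)   ≡⟨ bernoulli-recurrence m ⟩
    0ℚ                               ≡⟨ sym (ℚP.*-zeroʳ (ℕtoℚ (n !))) ⟩
    ℕtoℚ (n !) * 0ℚ                  ∎)
    where
    open ≡-Reasoning
    h = bernoulliGF
    e = expm1/z
    n = 2 ℕ.+ m
    binomial-term : ∀ k → k < n → ℕtoℚ (n !) * (h k * e (suc m ∸ k)) ≡ ℕtoℚ (n C k) * B k
    binomial-term k (s≤s k≤suc-m) = begin
      ℕtoℚ (n !) * (invFact k * B k * invFact (suc (suc m ∸ k)))
        ≡⟨ cong (λ t → ℕtoℚ (n !) * (invFact k * B k * invFact t)) (sym (ℕP.+-∸-assoc 1 k≤suc-m)) ⟩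
      ℕtoℚ (n !) * (invFact k * B k * invFact (n ∸ k))
        ≡⟨ solve 4 (λ a r b s → a :* (r :* b :* s) := a :* (r :* s) :* b) refl (ℕtoℚ (n !)) (invFact k) (B k) (invFact (n ∸ k)) ⟩
      ℕtoℚ (n !) * (invFact k * invFact (n ∸ k)) * B k
        ≡⟨ cong (_* B k) (sym (binomial≡factorials n k (ℕP.m≤n⇒m≤1+n k≤suc-m))) ⟩
      ℕtoℚ (n C k) * B k ∎

  -- e = (e^z − 1)/z satisfies (z e)′ = e^z = 1 + z e
  expm1/z-ode : one ⊕ shift expm1/z ⊕ scale (- 1ℚ) (θ expm1/z) ⊕ scale (- 1ℚ) expm1/z ≗ 0ˢ
  expm1/z-ode zero    = refl
  expm1/z-ode (suc k) = begin
    0ℚ + e k + - 1ℚ * (ℕtoℚ (suc k) * e (suc k)) + - 1ℚ * e (suc k)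
      ≡⟨ cong (λ t → 0ℚ + t + - 1ℚ * (ℕtoℚ (suc k) * e (suc k)) + - 1ℚ * e (suc k))
              (trans (invFact-suc (suc k)) (cong (e (suc k) *_) (ℕtoℚ-suc (suc k)))) ⟩
    0ℚ + e (suc k) * (1ℚ + ℕtoℚ (suc k)) + - 1ℚ * (ℕtoℚ (suc k) * e (suc k)) + - 1ℚ * e (suc k)
      ≡⟨ solve 2 (λ x a → con 0ℚ :+ x :* (con 1ℚ :+ a) :+ (:- con 1ℚ) :* (a :* x) :+ (:- con 1ℚ) :* x := con 0ℚ) refl (e (suc k)) (ℕtoℚ (suc k)) ⟩
    0ℚ ∎
    where
    open ≡-Reasoning
    e = expm1/z

  θ-⋆-inverse : ∀ a b → a ⋆ b ≗ one → θ a ⋆ b ≗ scale (- 1ℚ) (a ⋆ θ b)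
  θ-⋆-inverse a b a⋆b≗one n = begin
    (θ a ⋆ b) n                                         ≡⟨ solve 2 (λ x y → x := (x :+ y) :+ (:- con 1ℚ) :* y) refl ((θ a ⋆ b) n) ((a ⋆ θ b) n) ⟩
    ((θ a ⋆ b) n + (a ⋆ θ b) n) + - 1ℚ * (a ⋆ θ b) n    ≡⟨ cong (_+ - 1ℚ * (a ⋆ θ b) n) (sym (θ-⋆ a b n)) ⟩
    θ (a ⋆ b) n + - 1ℚ * (a ⋆ θ b) n                    ≡⟨ cong (λ t → ℕtoℚ n * t + - 1ℚ * (a ⋆ θ b) n) (a⋆b≗one n) ⟩
    θ one n + - 1ℚ * (a ⋆ θ b) n                        ≡⟨ cong (_+ - 1ℚ * (a ⋆ θ b) n) (θ-one n) ⟩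
    0ℚ + - 1ℚ * (a ⋆ θ b) n                             ≡⟨ ℚP.+-identityˡ (- 1ℚ * (a ⋆ θ b) n) ⟩
    - 1ℚ * (a ⋆ θ b) n                                  ∎
    where open ≡-Reasoning

  module Inverse (a e : Series) (a⋆e≗one : a ⋆ e ≗ one) where

    a⋆e²≗e : a ⋆ (e ⋆ e) ≗ e
    a⋆e²≗e = begin
      a ⋆ (e ⋆ e)   ≈⟨ (λ n → sym (⋆-assoc a e e n)) ⟩
      (a ⋆ e) ⋆ e   ≈⟨ ⋆-congˡ e a⋆e≗one ⟩
      one ⋆ e       ≈⟨ ⋆-identityˡ e ⟩
      e             ∎
      where open ≗-Reasoning

    a²⋆e²≗one : (a ⋆ a) ⋆ (e ⋆ e) ≗ one
    a²⋆e²≗one = begin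
      (a ⋆ a) ⋆ (e ⋆ e)   ≈⟨ ⋆-assoc a a (e ⋆ e) ⟩
      a ⋆ (a ⋆ (e ⋆ e))   ≈⟨ ⋆-congʳ a a⋆e²≗e ⟩
      a ⋆ e               ≈⟨ a⋆e≗one ⟩
      one                 ∎
      where open ≗-Reasoning

    θa⋆e²≗-θe : θ a ⋆ (e ⋆ e) ≗ scale (- 1ℚ) (θ e)
    θa⋆e²≗-θe = begin
      θ a ⋆ (e ⋆ e)                  ≈⟨ (λ n → sym (⋆-assoc (θ a) e e n)) ⟩
      (θ a ⋆ e) ⋆ e                  ≈⟨ ⋆-congˡ e (θ-⋆-inverse a e a⋆e≗one) ⟩
      scale (- 1ℚ) (a ⋆ θ e) ⋆ e     ≈⟨ scale-⋆ (- 1ℚ) (a ⋆ θ e) e ⟩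
      scale (- 1ℚ) ((a ⋆ θ e) ⋆ e)   ≈⟨ scale-cong (- 1ℚ) (⋆-congˡ e (⋆-comm a (θ e))) ⟩
      scale (- 1ℚ) ((θ e ⋆ a) ⋆ e)   ≈⟨ scale-cong (- 1ℚ) (⋆-assoc (θ e) a e) ⟩
      scale (- 1ℚ) (θ e ⋆ (a ⋆ e))   ≈⟨ scale-cong (- 1ℚ) (⋆-congʳ (θ e) a⋆e≗one) ⟩
      scale (- 1ℚ) (θ e ⋆ one)       ≈⟨ scale-cong (- 1ℚ) (⋆-identityʳ (θ e)) ⟩
      scale (- 1ℚ) (θ e)             ∎
      where open ≗-Reasoning

  bernoulli-riccati : bernoulliGF ⋆ bernoulliGF ⊕ shift bernoulliGF ⊕ θ bernoulliGF ⊕ scale (- 1ℚ) bernoulliGF ≗ 0ˢ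
  bernoulli-riccati = ⋆-cancelʳ _ (e ⋆ e) refl (begin
    (h ⋆ h ⊕ shift h ⊕ θ h ⊕ scale (- 1ℚ) h) ⋆ (e ⋆ e)
      ≈⟨ distrib ⟩
    (h ⋆ h) ⋆ (e ⋆ e) ⊕ shift h ⋆ (e ⋆ e) ⊕ θ h ⋆ (e ⋆ e) ⊕ scale (- 1ℚ) h ⋆ (e ⋆ e)
      ≈⟨ ⊕-cong (⊕-cong (⊕-cong a²⋆e²≗one (λ n → trans (shift-⋆ h (e ⋆ e) n) (shift-cong a⋆e²≗e n))) θa⋆e²≗-θe)
                (λ n → trans (scale-⋆ (- 1ℚ) h (e ⋆ e) n) (cong (- 1ℚ *_) (a⋆e²≗e n))) ⟩
    one ⊕ shift e ⊕ scale (- 1ℚ) (θ e) ⊕ scale (- 1ℚ) e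
      ≈⟨ expm1/z-ode ⟩
    0ˢ ∎)
    where
    open ≗-Reasoning
    open Inverse bernoulliGF expm1/z bernoulliGF⋆expm1/z
    h = bernoulliGF
    e = expm1/z
    distrib : (h ⋆ h ⊕ shift h ⊕ θ h ⊕ scale (- 1ℚ) h) ⋆ (e ⋆ e)
            ≗ (h ⋆ h) ⋆ (e ⋆ e) ⊕ shift h ⋆ (e ⋆ e) ⊕ θ h ⋆ (e ⋆ e) ⊕ scale (- 1ℚ) h ⋆ (e ⋆ e)
    distrib n = trans (⋆-distribʳ-⊕ (h ⋆ h ⊕ shift h ⊕ θ h) (scale (- 1ℚ) h) (e ⋆ e) n)
      (cong (_+ (scale (- 1ℚ) h ⋆ (e ⋆ e)) n) (trans (⋆-distribʳ-⊕ (h ⋆ h ⊕ shift h) (θ h) (e ⋆ e) n)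
        (cong (_+ (θ h ⋆ (e ⋆ e)) n) (⋆-distribʳ-⊕ (h ⋆ h) (shift h) (e ⋆ e) n))))

  z : Series
  z = shift one

  z⋆≗shift : ∀ a → z ⋆ a ≗ shift a
  z⋆≗shift a m = trans (shift-⋆ one a m) (shift-cong (⋆-identityˡ a) m)

  θ-z : θ z ≗ z
  θ-z zero          = refl
  θ-z (suc zero)    = refl
  θ-z (suc (suc m)) = ℚP.*-zeroʳ (ℕtoℚ (suc (suc m)))

  -- z/(e^z − 1) + z/2 = (z/2) coth (z/2), an even function
  cothSeries : Series
  cothSeries = bernoulliGF ⊕ scale ½ z

  cothSeries-riccati : ∀ m → (cothSeries ⋆ cothSeries) m ≡ cothSeries m + - 1ℚ * (ℕtoℚ m * cothSeries m) + ½ * ½ * shift z m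
  cothSeries-riccati m = begin
    (f ⋆ f) m
      ≡⟨ ⋆-distribʳ-⊕ h (scale ½ z) f m ⟩
    (h ⋆ f) m + (scale ½ z ⋆ f) m
      ≡⟨ cong₂ _+_ (⋆-comm h f m) (trans (scale-⋆ ½ z f m) (cong (½ *_) (z⋆≗shift f m))) ⟩
    (f ⋆ h) m + ½ * shift f m
      ≡⟨ cong₂ _+_ (trans (⋆-distribʳ-⊕ h (scale ½ z) h m) (cong ((h ⋆ h) m +_) (trans (scale-⋆ ½ z h m) (cong (½ *_) (z⋆≗shift h m)))))
                   (cong (½ *_) (shift-f m)) ⟩
    HH + ½ * Sh + ½ * (Sh + ½ * Sz)
      ≡⟨ solve 5 (λ hh sh m h sz → hh :+ con ½ :* sh :+ con ½ :* (sh :+ con ½ :* sz)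
                                := (hh :+ sh :+ m :* h :+ (:- con 1ℚ) :* h) :+ (h :+ (:- con 1ℚ) :* (m :* h) :+ con ½ :* con ½ :* sz))
                 refl HH Sh M H Sz ⟩
    (HH + Sh + M * H + - 1ℚ * H) + (H + - 1ℚ * (M * H) + ½ * ½ * Sz)
      ≡⟨ cong (_+ (H + - 1ℚ * (M * H) + ½ * ½ * Sz)) (bernoulli-riccati m) ⟩
    0ℚ + (H + - 1ℚ * (M * H) + ½ * ½ * Sz)
      ≡⟨ solve 4 (λ m h sz z → con 0ℚ :+ (h :+ (:- con 1ℚ) :* (m :* h) :+ con ½ :* con ½ :* sz)
                               := h :+ con ½ :* z :+ (:- con 1ℚ) :* (m :* h :+ con ½ :* z) :+ con ½ :* con ½ :* sz)
                 refl M H Sz (z m) ⟩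
    H + ½ * z m + - 1ℚ * (M * H + ½ * z m) + ½ * ½ * Sz
      ≡⟨ cong (λ t → H + ½ * z m + - 1ℚ * (M * H + ½ * t) + ½ * ½ * Sz) (sym (θ-z m)) ⟩
    H + ½ * z m + - 1ℚ * (M * H + ½ * (M * z m)) + ½ * ½ * Sz
      ≡⟨ solve 4 (λ m h sz z → h :+ con ½ :* z :+ (:- con 1ℚ) :* (m :* h :+ con ½ :* (m :* z)) :+ con ½ :* con ½ :* sz
                               := h :+ con ½ :* z :+ (:- con 1ℚ) :* (m :* (h :+ con ½ :* z)) :+ con ½ :* con ½ :* sz)
                 refl M H Sz (z m) ⟩
    f m + - 1ℚ * (M * f m) + ½ * ½ * Sz ∎
    where
    open ≡-Reasoning
    h = bernoulliGF
    f = cothSeries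
    HH = (h ⋆ h) m
    Sh = shift h m
    Sz = shift z m
    H = h m
    M = ℕtoℚ m
    shift-f : shift f ≗ shift h ⊕ scale ½ (shift z)
    shift-f zero    = refl
    shift-f (suc m) = refl

  cothSeries-odd-step : ∀ t → (∀ s → s ≤ t → cothSeries (suc (2 ℕ.* s)) ≡ 0ℚ) → cothSeries (3 ℕ.+ 2 ℕ.* t) ≡ 0ℚ
  cothSeries-odd-step t earlier = *-cancelˡ-ℕtoℚ (suc m) (begin
    ℕtoℚ (suc m) * f m                ≡⟨ cong (_* f m) (ℕtoℚ-suc m) ⟩
    (1ℚ + ℕtoℚ m) * f m
      ≡⟨ solve 2 (λ x n → (con 1ℚ :+ n) :* x := (x :+ x) :+ (:- (x :+ (:- con 1ℚ) :* (n :* x) :+ con ½ :* con ½ :* con 0ℚ))) refl (f m) (ℕtoℚ m) ⟩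
    (f m + f m) + - (f m + - 1ℚ * (ℕtoℚ m * f m) + ½ * ½ * 0ℚ)
      ≡⟨ cong₂ (λ u v → u + - v) (sym f⋆f≡2f) (sym (cothSeries-riccati m)) ⟩
    (f ⋆ f) m + - (f ⋆ f) m           ≡⟨ ℚP.+-inverseʳ ((f ⋆ f) m) ⟩
    0ℚ                                ≡⟨ sym (ℚP.*-zeroʳ (ℕtoℚ (suc m))) ⟩
    ℕtoℚ (suc m) * 0ℚ                 ∎)
    where
    open ≡-Reasoning
    f = cothSeries
    m′ = 2 ℕ.+ 2 ℕ.* t
    m = suc m′
    F : ℕ → ℚ
    F j = f j * f (m ∸ j)
    -- one of i + 1 and m − (i + 1) is odd and smaller than m
    middle-term : ∀ i → i < m′ → (∃[ s ] i ≡ 2 ℕ.* s) ⊎ (∃[ s ] i ≡ suc (2 ℕ.* s)) → F (suc i) ≡ 0ℚ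
    middle-term i i<m′ (inj₁ (s , refl)) =
      trans (cong (_* f (m ∸ suc (2 ℕ.* s))) (earlier s s≤t)) (ℚP.*-zeroˡ (f (m ∸ suc (2 ℕ.* s))))
      where
      s≤t : s ≤ t
      s≤t = ℕP.≤-pred (ℕP.*-cancelˡ-< 2 s (suc t) (subst (suc (2 ℕ.* s) ≤_) (sym (ℕP.*-suc 2 t)) i<m′))
    middle-term i i<m′ (inj₂ (s , refl)) =
      trans (cong (f (2 ℕ.+ 2 ℕ.* s) *_) (trans (cong f m-i-1≡odd) (earlier (t ∸ s) (ℕP.m∸n≤m t s))))
            (ℚP.*-zeroʳ (f (2 ℕ.+ 2 ℕ.* s)))
      where
      s≤t : s ≤ t
      s≤t = ℕP.*-cancelˡ-≤ 2 (ℕP.≤-pred (ℕP.≤-pred i<m′))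
      m-i-1≡odd : m ∸ (2 ℕ.+ 2 ℕ.* s) ≡ suc (2 ℕ.* (t ∸ s))
      m-i-1≡odd = trans (ℕP.+-∸-assoc 1 (ℕP.*-monoʳ-≤ 2 s≤t)) (cong suc (sym (ℕP.*-distribˡ-∸ 2 t s)))
    f⋆f≡2f : (f ⋆ f) m ≡ f m + f m
    f⋆f≡2f = begin
      F 0 + Σ m (F ∘ suc)                    ≡⟨ cong (F 0 +_) (Σ-last m′ (F ∘ suc)) ⟩
      F 0 + (Σ m′ (F ∘ suc) + F m)           ≡⟨ cong (λ x → F 0 + (x + F m)) (Σ-zero m′ (λ i i<m′ → middle-term i i<m′ (even⊎odd i))) ⟩
      F 0 + (0ℚ + F m)                       ≡⟨ cong (F 0 +_) (ℚP.+-identityˡ (F m)) ⟩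
      1ℚ * f m + f m * f (m ∸ m)             ≡⟨ cong (λ k → 1ℚ * f m + f m * f k) (ℕP.n∸n≡0 m) ⟩
      1ℚ * f m + f m * 1ℚ                    ≡⟨ cong₂ _+_ (ℚP.*-identityˡ (f m)) (ℚP.*-identityʳ (f m)) ⟩
      f m + f m                              ∎

  cothSeries-odd : ∀ s → cothSeries (suc (2 ℕ.* s)) ≡ 0ℚ
  cothSeries-odd = <-rec _ odd
    where
    odd : ∀ s → (∀ {s′} → s′ < s → cothSeries (suc (2 ℕ.* s′)) ≡ 0ℚ) → cothSeries (suc (2 ℕ.* s)) ≡ 0ℚ
    odd zero    _       = refl
    odd (suc t) earlier = subst (λ k → cothSeries (suc k) ≡ 0ℚ) (sym (ℕP.*-suc 2 t))
                                (cothSeries-odd-step t (λ s s≤t → earlier (s≤s s≤t)))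

  -- The even series g(w) = Σ B_{2j} w^j/(2j)! and its powers

  ⋆-even : ∀ a b → (∀ s → a (suc (2 ℕ.* s)) ≡ 0ℚ) → ∀ n →
    (a ⋆ b) (2 ℕ.* n) ≡ Σ (suc n) (λ j → a (2 ℕ.* j) * b (2 ℕ.* (n ∸ j)))
  ⋆-even a b a-odd n = begin
    (a ⋆ b) (2 ℕ.* n)
      ≡⟨ Σ-even-odd n (λ j → a j * b (2 ℕ.* n ∸ j)) ⟩
    Σ (suc n) (λ j → a (2 ℕ.* j) * b (2 ℕ.* n ∸ 2 ℕ.* j)) + Σ n (λ j → a (suc (2 ℕ.* j)) * b (2 ℕ.* n ∸ suc (2 ℕ.* j)))
      ≡⟨ cong₂ _+_ (Σ-cong′ (suc n) (λ j → cong (λ k → a (2 ℕ.* j) * b k) (sym (ℕP.*-distribˡ-∸ 2 n j))))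
                   (Σ-zero n (λ j _ → trans (cong (_* b (2 ℕ.* n ∸ suc (2 ℕ.* j))) (a-odd j)) (ℚP.*-zeroˡ (b (2 ℕ.* n ∸ suc (2 ℕ.* j)))))) ⟩
    Σ (suc n) (λ j → a (2 ℕ.* j) * b (2 ℕ.* (n ∸ j))) + 0ℚ
      ≡⟨ ℚP.+-identityʳ _ ⟩
    Σ (suc n) (λ j → a (2 ℕ.* j) * b (2 ℕ.* (n ∸ j))) ∎
    where open ≡-Reasoning

  bernoulliEvenGF : Series
  bernoulliEvenGF j = invFact (2 ℕ.* j) * B (2 ℕ.* j)

  cothSeries-even : ∀ j → cothSeries (2 ℕ.* j) ≡ bernoulliEvenGF j
  cothSeries-even j = trans (cong (λ t → bernoulliEvenGF j + ½ * t) (z-even j))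
                            (solve 1 (λ x → x :+ con ½ :* con 0ℚ := x) refl (bernoulliEvenGF j))
    where
    z-even : ∀ j → z (2 ℕ.* j) ≡ 0ℚ
    z-even zero    = refl
    z-even (suc j) = cong z (ℕP.*-suc 2 j)

  bernoulliEvenGF-riccati : bernoulliEvenGF ⋆ bernoulliEvenGF ≗ bernoulliEvenGF ⊕ scale (- ℕtoℚ 2) (θ bernoulliEvenGF) ⊕ scale (½ * ½) z
  bernoulliEvenGF-riccati n = begin
    (g ⋆ g) n
      ≡⟨ Σ-cong′ (suc n) (λ j → sym (cong₂ _*_ (cothSeries-even j) (cothSeries-even (n ∸ j)))) ⟩
    Σ (suc n) (λ j → f (2 ℕ.* j) * f (2 ℕ.* (n ∸ j)))
      ≡⟨ sym (⋆-even f f cothSeries-odd n) ⟩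
    (f ⋆ f) (2 ℕ.* n)
      ≡⟨ cothSeries-riccati (2 ℕ.* n) ⟩
    f (2 ℕ.* n) + - 1ℚ * (ℕtoℚ (2 ℕ.* n) * f (2 ℕ.* n)) + ½ * ½ * shift z (2 ℕ.* n)
      ≡⟨ cong₃ (λ u v w → u + - 1ℚ * (v * u) + ½ * ½ * w) (cothSeries-even n) (ℕtoℚ-* 2 n) (shift-z-even n) ⟩
    g n + - 1ℚ * (ℕtoℚ 2 * ℕtoℚ n * g n) + ½ * ½ * z n
      ≡⟨ solve 3 (λ x m w → x :+ (:- con 1ℚ) :* (con (ℕtoℚ 2) :* m :* x) :+ con ½ :* con ½ :* w
                         := x :+ (:- con (ℕtoℚ 2)) :* (m :* x) :+ con ½ :* con ½ :* w) refl (g n) (ℕtoℚ n) (z n) ⟩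
    g n + - ℕtoℚ 2 * (ℕtoℚ n * g n) + ½ * ½ * z n ∎
    where
    open ≡-Reasoning
    f = cothSeries
    g = bernoulliEvenGF
    cong₃ : ∀ (F : ℚ → ℚ → ℚ → ℚ) {x x′ y y′ w w′} → x ≡ x′ → y ≡ y′ → w ≡ w′ → F x y w ≡ F x′ y′ w′
    cong₃ F refl refl refl = refl
    shift-z-even : ∀ n → shift z (2 ℕ.* n) ≡ z n
    shift-z-even zero          = refl
    shift-z-even (suc zero)    = refl
    shift-z-even (suc (suc n)) = trans (cong (shift z) (ℕP.*-suc 2 (suc n))) (cong (λ k → one (suc k)) (ℕP.*-suc 2 n))

  infixr 8 _^ˢ_

  _^ˢ_ : Series → ℕ → Series
  a ^ˢ zero  = one
  a ^ˢ suc N = a ⋆ a ^ˢ N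

  θ-^ˢ : ∀ a N n → ℕtoℚ n * (a ^ˢ suc N) n ≡ ℕtoℚ (suc N) * (θ a ⋆ a ^ˢ N) n
  θ-^ˢ a zero n = begin
    θ (a ⋆ one) n                        ≡⟨ θ-⋆ a one n ⟩
    (θ a ⋆ one) n + (a ⋆ θ one) n        ≡⟨ cong ((θ a ⋆ one) n +_) (trans (⋆-congʳ a θ-one n) (Σ-zero (suc n) (λ j _ → ℚP.*-zeroʳ (a j)))) ⟩
    (θ a ⋆ one) n + 0ℚ                   ≡⟨ solve 1 (λ x → x :+ con 0ℚ := con 1ℚ :* x) refl ((θ a ⋆ one) n) ⟩
    1ℚ * (θ a ⋆ one) n                   ∎
    where open ≡-Reasoning
  θ-^ˢ a (suc N) n = begin
    θ (a ⋆ a ^ˢ suc N) n                                          ≡⟨ θ-⋆ a (a ^ˢ suc N) n ⟩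
    (θ a ⋆ a ^ˢ suc N) n + (a ⋆ θ (a ^ˢ suc N)) n
      ≡⟨ cong ((θ a ⋆ a ^ˢ suc N) n +_) (trans (⋆-congʳ a (θ-^ˢ a N) n) (⋆-scale (ℕtoℚ (suc N)) a (θ a ⋆ a ^ˢ N) n)) ⟩
    (θ a ⋆ a ^ˢ suc N) n + ℕtoℚ (suc N) * (a ⋆ (θ a ⋆ a ^ˢ N)) n
      ≡⟨ cong (λ t → (θ a ⋆ a ^ˢ suc N) n + ℕtoℚ (suc N) * t) reorder ⟩
    (θ a ⋆ a ^ˢ suc N) n + ℕtoℚ (suc N) * (θ a ⋆ a ^ˢ suc N) n
      ≡⟨ solve 2 (λ x c → x :+ c :* x := (con 1ℚ :+ c) :* x) refl ((θ a ⋆ a ^ˢ suc N) n) (ℕtoℚ (suc N)) ⟩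
    (1ℚ + ℕtoℚ (suc N)) * (θ a ⋆ a ^ˢ suc N) n                    ≡⟨ cong (_* (θ a ⋆ a ^ˢ suc N) n) (sym (ℕtoℚ-suc (suc N))) ⟩
    ℕtoℚ (2 ℕ.+ N) * (θ a ⋆ a ^ˢ suc N) n                         ∎
    where
    open ≡-Reasoning
    reorder : (a ⋆ (θ a ⋆ a ^ˢ N)) n ≡ (θ a ⋆ a ^ˢ suc N) n
    reorder = begin
      (a ⋆ (θ a ⋆ a ^ˢ N)) n   ≡⟨ sym (⋆-assoc a (θ a) (a ^ˢ N) n) ⟩
      ((a ⋆ θ a) ⋆ a ^ˢ N) n   ≡⟨ ⋆-congˡ (a ^ˢ N) (⋆-comm a (θ a)) n ⟩
      ((θ a ⋆ a) ⋆ a ^ˢ N) n   ≡⟨ ⋆-assoc (θ a) a (a ^ˢ N) n ⟩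
      (θ a ⋆ a ^ˢ suc N) n     ∎

  ^ˢ-riccati : ∀ a c d → a ⋆ a ≗ a ⊕ scale c (θ a) ⊕ scale d z →
    ∀ N → a ^ˢ (2 ℕ.+ N) ≗ a ^ˢ suc N ⊕ scale c (θ a ⋆ a ^ˢ N) ⊕ scale d (shift (a ^ˢ N))
  ^ˢ-riccati a c d quadratic N = begin
    a ⋆ (a ⋆ a ^ˢ N)                                      ≈⟨ (λ n → sym (⋆-assoc a a (a ^ˢ N) n)) ⟩
    (a ⋆ a) ⋆ a ^ˢ N                                      ≈⟨ ⋆-congˡ (a ^ˢ N) quadratic ⟩
    (a ⊕ scale c (θ a) ⊕ scale d z) ⋆ a ^ˢ N              ≈⟨ ⋆-distribʳ-⊕ (a ⊕ scale c (θ a)) (scale d z) (a ^ˢ N) ⟩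
    (a ⊕ scale c (θ a)) ⋆ a ^ˢ N ⊕ scale d z ⋆ a ^ˢ N     ≈⟨ ⊕-cong (⋆-distribʳ-⊕ a (scale c (θ a)) (a ^ˢ N)) (scale-⋆ d z (a ^ˢ N)) ⟩
    a ^ˢ suc N ⊕ scale c (θ a) ⋆ a ^ˢ N ⊕ scale d (z ⋆ a ^ˢ N)
      ≈⟨ ⊕-cong (⊕-cong {a ^ˢ suc N} (λ _ → refl) (scale-⋆ c (θ a) (a ^ˢ N))) (scale-cong d (z⋆≗shift (a ^ˢ N))) ⟩
    a ^ˢ suc N ⊕ scale c (θ a ⋆ a ^ˢ N) ⊕ scale d (shift (a ^ˢ N)) ∎
    where open ≗-Reasoning

  bernoulliEvenGF^-recurrence : ∀ M t n → M ℕ.+ t ≡ 2 ℕ.* n →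
    ℕtoℚ (suc M) * (bernoulliEvenGF ^ˢ (2 ℕ.+ M)) (suc n)
      ≡ - ℕtoℚ (suc t) * (bernoulliEvenGF ^ˢ suc M) (suc n) + ½ * ½ * ℕtoℚ (suc M) * (bernoulliEvenGF ^ˢ M) n
  bernoulliEvenGF^-recurrence M t n M+t≡2n = begin
    ℕtoℚ (suc M) * (g ^ˢ (2 ℕ.+ M)) (suc n)
      ≡⟨ cong (ℕtoℚ (suc M) *_) (^ˢ-riccati g (- ℕtoℚ 2) (½ * ½) bernoulliEvenGF-riccati M (suc n)) ⟩
    ℕtoℚ (suc M) * (G + - ℕtoℚ 2 * D + ½ * ½ * Gₘ)
      ≡⟨ solve 4 (λ k G D S → k :* (G :+ (:- con (ℕtoℚ 2)) :* D :+ con ½ :* con ½ :* S)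
                           := k :* G :+ (:- con (ℕtoℚ 2)) :* (k :* D) :+ con ½ :* con ½ :* k :* S) refl (ℕtoℚ (suc M)) G D Gₘ ⟩
    ℕtoℚ (suc M) * G + - ℕtoℚ 2 * (ℕtoℚ (suc M) * D) + ½ * ½ * ℕtoℚ (suc M) * Gₘ
      ≡⟨ cong (λ x → ℕtoℚ (suc M) * G + - ℕtoℚ 2 * x + ½ * ½ * ℕtoℚ (suc M) * Gₘ) (sym (θ-^ˢ g M (suc n))) ⟩
    ℕtoℚ (suc M) * G + - ℕtoℚ 2 * (ℕtoℚ (suc n) * G) + ½ * ½ * ℕtoℚ (suc M) * Gₘ
      ≡⟨ cong₂ (λ x y → x * G + - ℕtoℚ 2 * (y * G) + ½ * ½ * ℕtoℚ (suc M) * Gₘ) (ℕtoℚ-suc M) (ℕtoℚ-suc n) ⟩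
    (1ℚ + m) * G + - ℕtoℚ 2 * ((1ℚ + ℕtoℚ n) * G) + R
      ≡⟨ solve 4 (λ m n G R → (con 1ℚ :+ m) :* G :+ (:- con (ℕtoℚ 2)) :* ((con 1ℚ :+ n) :* G) :+ R
                           := (:- (con 1ℚ :+ (con (ℕtoℚ 2) :* n :+ (:- m)))) :* G :+ R) refl m (ℕtoℚ n) G R ⟩
    - (1ℚ + (ℕtoℚ 2 * ℕtoℚ n + - m)) * G + R
      ≡⟨ cong (λ x → - (1ℚ + (x + - m)) * G + R) two-n ⟩
    - (1ℚ + (m + ℕtoℚ t + - m)) * G + R
      ≡⟨ solve 4 (λ m t G R → (:- (con 1ℚ :+ (m :+ t :+ (:- m)))) :* G :+ R := (:- (con 1ℚ :+ t)) :* G :+ R) refl m (ℕtoℚ t) G R ⟩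
    - (1ℚ + ℕtoℚ t) * G + R
      ≡⟨ cong (λ x → - x * G + R) (sym (ℕtoℚ-suc t)) ⟩
    - ℕtoℚ (suc t) * G + R ∎
    where
    open ≡-Reasoning
    g = bernoulliEvenGF
    G = (g ^ˢ suc M) (suc n)
    D = (θ g ⋆ g ^ˢ M) (suc n)
    Gₘ = (g ^ˢ M) n
    R = ½ * ½ * ℕtoℚ (suc M) * Gₘ
    m = ℕtoℚ M
    two-n : ℕtoℚ 2 * ℕtoℚ n ≡ m + ℕtoℚ t
    two-n = trans (sym (ℕtoℚ-* 2 n)) (trans (cong ℕtoℚ (sym M+t≡2n)) (ℕtoℚ-+ M t))

  sumℚ-++ : ∀ (xs ys : List ℚ) → sumℚ (xs ++ ys) ≡ sumℚ xs + sumℚ ys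
  sumℚ-++ []       ys = sym (ℚP.+-identityˡ (sumℚ ys))
  sumℚ-++ (x ∷ xs) ys = trans (cong (x +_) (sumℚ-++ xs ys)) (sym (ℚP.+-assoc x (sumℚ xs) (sumℚ ys)))

  sumℚ-map-*ˡ : ∀ {A : Set} (c : ℚ) (F : A → ℚ) (xs : List A) → sumℚ (map (λ x → c * F x) xs) ≡ c * sumℚ (map F xs)
  sumℚ-map-*ˡ c F []       = sym (ℚP.*-zeroʳ c)
  sumℚ-map-*ˡ c F (x ∷ xs) = trans (cong (c * F x +_) (sumℚ-map-*ˡ c F xs)) (sym (ℚP.*-distribˡ-+ c (F x) (sumℚ (map F xs))))

  sumℚ-map-concatMap : ∀ {A B : Set} (F : B → ℚ) (G : A → List B) (xs : List A) →
    sumℚ (map F (concatMap G xs)) ≡ sumℚ (map (λ x → sumℚ (map F (G x))) xs)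
  sumℚ-map-concatMap F G []       = refl
  sumℚ-map-concatMap F G (x ∷ xs) = trans (cong sumℚ (ListP.map-++ F (G x) (concatMap G xs)))
    (trans (sumℚ-++ (map F (G x)) (map F (concatMap G xs))) (cong (sumℚ (map F (G x)) +_) (sumℚ-map-concatMap F G xs)))

  vecProduct : ∀ {N} → Series → Vec ℕ N → ℚ
  vecProduct a Vec.[]       = 1ℚ
  vecProduct a (j Vec.∷ js) = a j * vecProduct a js

  sumℚ-vecProduct-comps : ∀ a N n → sumℚ (map (vecProduct a) (comps N n)) ≡ (a ^ˢ N) n
  sumℚ-vecProduct-comps a zero    zero    = refl
  sumℚ-vecProduct-comps a zero    (suc n) = refl
  sumℚ-vecProduct-comps a (suc N) n = begin
    sumℚ (map (vecProduct a) (concatMap (λ j → map (j Vec.∷_) (comps N (n ∸ j))) (upTo (suc n))))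
      ≡⟨ sumℚ-map-concatMap (vecProduct a) (λ j → map (j Vec.∷_) (comps N (n ∸ j))) (upTo (suc n)) ⟩
    sumℚ (map column (upTo (suc n)))
      ≡⟨ cong sumℚ (ListP.map-upTo column (suc n)) ⟩
    sumℚ (applyUpTo column (suc n))
      ≡⟨ sumℚ-applyUpTo (suc n) column ⟩
    Σ (suc n) column
      ≡⟨ Σ-cong′ (suc n) first-part ⟩
    (a ⋆ a ^ˢ N) n ∎
    where
    open ≡-Reasoning
    column : ℕ → ℚ
    column j = sumℚ (map (vecProduct a) (map (j Vec.∷_) (comps N (n ∸ j))))
    first-part : ∀ j → column j ≡ a j * (a ^ˢ N) (n ∸ j)
    first-part j = begin
      column j                                                ≡⟨ cong sumℚ (sym (ListP.map-∘ (comps N (n ∸ j)))) ⟩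
      sumℚ (map (λ js → a j * vecProduct a js) (comps N (n ∸ j)))  ≡⟨ sumℚ-map-*ˡ (a j) (vecProduct a) (comps N (n ∸ j)) ⟩
      a j * sumℚ (map (vecProduct a) (comps N (n ∸ j)))        ≡⟨ cong (a j *_) (sumℚ-vecProduct-comps a N (n ∸ j)) ⟩
      a j * (a ^ˢ N) (n ∸ j)                                  ∎

  termProd≡vecProduct : ∀ {N} (js : Vec ℕ N) → termProd js ≡ vecProduct bernoulliEvenGF js
  termProd≡vecProduct Vec.[]       = refl
  termProd≡vecProduct (j Vec.∷ js) = cong (bernoulliEvenGF j *_) (termProd≡vecProduct js)

  S≡bernoulliEvenGF^ : ∀ N n → S N n ≡ ℕtoℚ ((2 ℕ.* n) !) * (bernoulliEvenGF ^ˢ N) n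
  S≡bernoulliEvenGF^ N n = begin
    sumℚ (map (λ js → ℕtoℚ ((2 ℕ.* n) !) * termProd js) (comps N n))
      ≡⟨ sumℚ-map-*ˡ (ℕtoℚ ((2 ℕ.* n) !)) termProd (comps N n) ⟩
    ℕtoℚ ((2 ℕ.* n) !) * sumℚ (map termProd (comps N n))
      ≡⟨ cong (λ xs → ℕtoℚ ((2 ℕ.* n) !) * sumℚ xs) (ListP.map-cong termProd≡vecProduct (comps N n)) ⟩
    ℕtoℚ ((2 ℕ.* n) !) * sumℚ (map (vecProduct bernoulliEvenGF) (comps N n))
      ≡⟨ cong (ℕtoℚ ((2 ℕ.* n) !) *_) (sumℚ-vecProduct-comps bernoulliEvenGF N n) ⟩
    ℕtoℚ ((2 ℕ.* n) !) * (bernoulliEvenGF ^ˢ N) n ∎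
    where open ≡-Reasoning

  nth-length≤ : ∀ (p : Poly) k → length p ≤ k → nth p k ≡ 0ℚ
  nth-length≤ []      k       _          = refl
  nth-length≤ (x ∷ p) (suc k) (s≤s p≤k) = nth-length≤ p k p≤k

  nth-addP : ∀ p q k → nth (addP p q) k ≡ nth p k + nth q k
  nth-addP []      q       k       = sym (ℚP.+-identityˡ (nth q k))
  nth-addP (a ∷ p) []      k       = sym (ℚP.+-identityʳ (nth (a ∷ p) k))
  nth-addP (a ∷ p) (b ∷ q) zero    = refl
  nth-addP (a ∷ p) (b ∷ q) (suc k) = nth-addP p q k

  nth-scaleP : ∀ c p k → nth (scaleP c p) k ≡ c * nth p k
  nth-scaleP c []      k       = sym (ℚP.*-zeroʳ c)
  nth-scaleP c (a ∷ p) zero    = refl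
  nth-scaleP c (a ∷ p) (suc k) = nth-scaleP c p k

  nth-shiftP-< : ∀ s p k → k < s → nth (shiftP s p) k ≡ 0ℚ
  nth-shiftP-< (suc s) p zero    _         = refl
  nth-shiftP-< (suc s) p (suc k) (s≤s k<s) = nth-shiftP-< s p k k<s

  nth-shiftP-+ : ∀ s p k → nth (shiftP s p) (s ℕ.+ k) ≡ nth p k
  nth-shiftP-+ zero    p k = refl
  nth-shiftP-+ (suc s) p k = nth-shiftP-+ s p k

  nth-sumP : ∀ (ps : List Poly) k → nth (sumP ps) k ≡ sumℚ (map (λ p → nth p k) ps)
  nth-sumP []       k = refl
  nth-sumP (p ∷ ps) k = trans (nth-addP p (sumP ps) k) (cong (nth p k +_) (nth-sumP ps k))

  nth-mulP-linear : ∀ p x y k → nth (mulP p (x ∷ y ∷ [])) k ≡ x * nth p k + y * nth (0ℚ ∷ p) k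
  nth-mulP-linear []      x y zero    = solve 2 (λ x y → con 0ℚ := x :* con 0ℚ :+ y :* con 0ℚ) refl x y
  nth-mulP-linear []      x y (suc k) = solve 2 (λ x y → con 0ℚ := x :* con 0ℚ :+ y :* con 0ℚ) refl x y
  nth-mulP-linear (a ∷ p) x y zero    = solve 3 (λ a x y → a :* x :+ con 0ℚ := x :* a :+ y :* con 0ℚ) refl a x y
  nth-mulP-linear (a ∷ p) x y (suc zero) = begin
    nth (addP (a * y ∷ []) (mulP p (x ∷ y ∷ []))) 0  ≡⟨ nth-addP (a * y ∷ []) (mulP p (x ∷ y ∷ [])) 0 ⟩
    a * y + nth (mulP p (x ∷ y ∷ [])) 0             ≡⟨ cong (a * y +_) (nth-mulP-linear p x y 0) ⟩
    a * y + (x * nth p 0 + y * 0ℚ)                  ≡⟨ solve 4 (λ a x y q → a :* y :+ (x :* q :+ y :* con 0ℚ) := x :* q :+ y :* a) refl a x y (nth p 0) ⟩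
    x * nth p 0 + y * a                             ∎
    where open ≡-Reasoning
  nth-mulP-linear (a ∷ p) x y (suc (suc k)) = begin
    nth (addP (scaleP a (x ∷ y ∷ [])) (0ℚ ∷ mulP p (x ∷ y ∷ []))) (2 ℕ.+ k)
      ≡⟨ nth-addP (scaleP a (x ∷ y ∷ [])) (0ℚ ∷ mulP p (x ∷ y ∷ [])) (2 ℕ.+ k) ⟩
    0ℚ + nth (mulP p (x ∷ y ∷ [])) (suc k)           ≡⟨ ℚP.+-identityˡ (nth (mulP p (x ∷ y ∷ [])) (suc k)) ⟩
    nth (mulP p (x ∷ y ∷ [])) (suc k)                ≡⟨ nth-mulP-linear p x y (suc k) ⟩
    x * nth p (suc k) + y * nth (0ℚ ∷ p) (suc k)     ∎
    where open ≡-Reasoning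

  sumℚ-zipWith-applyUpTo : ∀ (F : ℕ → ℚ → ℚ) (φ : ℕ → ℕ) (p : Poly) →
    sumℚ (zipWith F (applyUpTo φ (length p)) p) ≡ Σ (length p) (λ k → F (φ k) (nth p k))
  sumℚ-zipWith-applyUpTo F φ []      = refl
  sumℚ-zipWith-applyUpTo F φ (x ∷ p) = cong (F (φ 0) x +_) (sumℚ-zipWith-applyUpTo F (φ ∘ suc) p)

  umbral≡Σ : ∀ p → umbral p ≡ Σ (length p) (λ k → nth p k * umbralCoeff k)
  umbral≡Σ = sumℚ-zipWith-applyUpTo (λ j c → c * umbralCoeff j) id

  umbral-truncate : ∀ p L → (∀ k → L ≤ k → nth p k ≡ 0ℚ) → umbral p ≡ Σ L (λ k → nth p k * umbralCoeff k)
  umbral-truncate p L vanish = begin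
    umbral p                                  ≡⟨ umbral≡Σ p ⟩
    Σ (length p) F                            ≡⟨ sym (Σ-vanishing-tail (length p) (length p ℕ.+ L) F (λ k p≤k → zero-coeff k (nth-length≤ p k p≤k)) (ℕP.m≤m+n _ L)) ⟩
    Σ (length p ℕ.+ L) F                      ≡⟨ Σ-vanishing-tail L (length p ℕ.+ L) F (λ k L≤k → zero-coeff k (vanish k L≤k)) (ℕP.m≤n+m L _) ⟩
    Σ L F                                     ∎
    where
    open ≡-Reasoning
    F : ℕ → ℚ
    F k = nth p k * umbralCoeff k
    zero-coeff : ∀ k → nth p k ≡ 0ℚ → F k ≡ 0ℚ
    zero-coeff k eq = trans (cong (_* umbralCoeff k) eq) (ℚP.*-zeroˡ (umbralCoeff k))

  -- The hypergeometric polynomials F_N = ₂F₁(1 − N, 1 + β; 2 | 2) and their contiguous relation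

  risingβ : ℕ → Poly
  risingβ = pochP (addP (constP 1ℚ) βP)

  nth-risingβ-suc : ∀ l k → nth (risingβ (suc l)) k ≡ ℕtoℚ (suc l) * nth (risingβ l) k + nth (0ℚ ∷ risingβ l) k
  nth-risingβ-suc l k = trans (nth-mulP-linear (risingβ l) ((1ℚ + 0ℚ) + ℕtoℚ l) 1ℚ k)
    (cong₂ _+_ (cong (_* nth (risingβ l) k) (sym (ℕtoℚ-suc l))) (ℚP.*-identityˡ (nth (0ℚ ∷ risingβ l) k)))

  nth-risingβ-> : ∀ l k → l < k → nth (risingβ l) k ≡ 0ℚ
  nth-risingβ-> zero    (suc k) _         = refl
  nth-risingβ-> (suc l) (suc k) (s≤s l<k) = begin
    nth (risingβ (suc l)) (suc k)                          ≡⟨ nth-risingβ-suc l (suc k) ⟩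
    ℕtoℚ (suc l) * nth (risingβ l) (suc k) + nth (risingβ l) k
      ≡⟨ cong₂ (λ a b → ℕtoℚ (suc l) * a + b) (nth-risingβ-> l (suc k) (ℕP.m<n⇒m<1+n l<k)) (nth-risingβ-> l k l<k) ⟩
    ℕtoℚ (suc l) * 0ℚ + 0ℚ                                 ≡⟨ trans (ℚP.+-identityʳ (ℕtoℚ (suc l) * 0ℚ)) (ℚP.*-zeroʳ (ℕtoℚ (suc l))) ⟩
    0ℚ                                                     ∎
    where open ≡-Reasoning

  pochℚ-suc-shift : ∀ x l → pochℚ x (suc l) ≡ x * pochℚ (x + 1ℚ) l
  pochℚ-suc-shift x zero    = solve 1 (λ x → con 1ℚ :* (x :+ con 0ℚ) := x :* con 1ℚ) refl x
  pochℚ-suc-shift x (suc l) = begin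
    pochℚ x (suc l) * (x + ℕtoℚ (suc l))          ≡⟨ cong₂ _*_ (pochℚ-suc-shift x l) (cong (x +_) (ℕtoℚ-suc l)) ⟩
    x * pochℚ (x + 1ℚ) l * (x + (1ℚ + ℕtoℚ l))    ≡⟨ solve 3 (λ x q L → x :* q :* (x :+ (con 1ℚ :+ L)) := x :* (q :* (x :+ con 1ℚ :+ L))) refl x (pochℚ (x + 1ℚ) l) (ℕtoℚ l) ⟩
    x * (pochℚ (x + 1ℚ) l * (x + 1ℚ + ℕtoℚ l))    ∎
    where open ≡-Reasoning

  oneMinus : ℕ → ℚ
  oneMinus N = 1ℚ + - ℕtoℚ N

  oneMinus-suc : ∀ N → oneMinus (suc N) + 1ℚ ≡ oneMinus N
  oneMinus-suc N = trans (cong (λ t → 1ℚ + - t + 1ℚ) (ℕtoℚ-suc N))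
    (solve 1 (λ n → con 1ℚ :+ (:- (con 1ℚ :+ n)) :+ con 1ℚ := con 1ℚ :+ (:- n)) refl (ℕtoℚ N))

  pochℚ-oneMinus-> : ∀ M l → M < l → pochℚ (oneMinus (suc M)) l ≡ 0ℚ
  pochℚ-oneMinus-> M (suc l) (s≤s M≤l) with ℕP.m≤n⇒m<n∨m≡n M≤l
  ... | inj₁ M<l  = trans (cong (_* (oneMinus (suc M) + ℕtoℚ l)) (pochℚ-oneMinus-> M l M<l))
                          (ℚP.*-zeroˡ (oneMinus (suc M) + ℕtoℚ l))
  ... | inj₂ refl = trans (cong (pochℚ (oneMinus (suc M)) M *_) last-factor) (ℚP.*-zeroʳ (pochℚ (oneMinus (suc M)) M))
    where
    last-factor : oneMinus (suc M) + ℕtoℚ M ≡ 0ℚ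
    last-factor = trans (cong (λ t → 1ℚ + - t + ℕtoℚ M) (ℕtoℚ-suc M))
      (solve 1 (λ m → con 1ℚ :+ (:- (con 1ℚ :+ m)) :+ m := con 0ℚ) refl (ℕtoℚ M))

  -- (2)_l l!, the denominator of the l-th term of ₂F₁(a, b; 2 | x)
  hypDenom : ℕ → ℕ
  hypDenom l = pochℕ 2 l ℕ.* l !

  hypDenom≢0 : ∀ l → NonZero (hypDenom l)
  hypDenom≢0 l = m*n≢0 (pochℕ 2 l) (l !) {{pochℕ-suc≢0 1 l}} {{l !≢0}}

  recipHypDenom : ℕ → ℚ
  recipHypDenom l = recipℕ (hypDenom l) {{hypDenom≢0 l}}

  recipHypDenom-suc : ∀ l → recipHypDenom l ≡ recipHypDenom (suc l) * ℕtoℚ ((2 ℕ.+ l) ℕ.* suc l)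
  recipHypDenom-suc l =
    recipℕ-exact-divisor (hypDenom l) ((2 ℕ.+ l) ℕ.* suc l) (hypDenom (suc l)) {{hypDenom≢0 l}} {{hypDenom≢0 (suc l)}}
      (solveℕ 4 (λ p f c d → (p ⊗ f) ⊗ (c ⊗ d) ⊜ (p ⊗ c) ⊗ (d ⊗ f)) refl (pochℕ 2 l) (l !) (2 ℕ.+ l) (suc l))
    where open ℕSolver.+-*-Solver renaming (solve to solveℕ; _:*_ to _⊗_; _:=_ to _⊜_)

  hypCoeff : ℕ → ℕ → ℚ
  hypCoeff N l = pochℚ (oneMinus N) l * powℚ (ℕtoℚ 2) l * recipHypDenom l

  hypCoeff-> : ∀ M l → M < l → hypCoeff (suc M) l ≡ 0ℚ
  hypCoeff-> M l M<l = trans (cong (λ t → t * powℚ (ℕtoℚ 2) l * recipHypDenom l) (pochℚ-oneMinus-> M l M<l))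
    (solve 2 (λ a b → con 0ℚ :* a :* b := con 0ℚ) refl (powℚ (ℕtoℚ 2) l) (recipHypDenom l))

  hypPoly : ℕ → Poly
  hypPoly N = hyp2F1 (oneMinus N) (addP (constP 1ℚ) βP) 1 (ℕtoℚ 2) N

  nth-hypPoly : ∀ N k → nth (hypPoly N) k ≡ Σ N (λ l → hypCoeff N l * nth (risingβ l) k)
  nth-hypPoly N k = begin
    nth (sumP (map term (upTo N))) k                 ≡⟨ nth-sumP (map term (upTo N)) k ⟩
    sumℚ (map (λ p → nth p k) (map term (upTo N)))   ≡⟨ cong sumℚ (sym (ListP.map-∘ (upTo N))) ⟩
    sumℚ (map (λ l → nth (term l) k) (upTo N))       ≡⟨ cong sumℚ (ListP.map-upTo (λ l → nth (term l) k) N) ⟩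
    sumℚ (applyUpTo (λ l → nth (term l) k) N)        ≡⟨ sumℚ-applyUpTo N (λ l → nth (term l) k) ⟩
    Σ N (λ l → nth (term l) k)                       ≡⟨ Σ-cong′ N (λ l → nth-scaleP (hypCoeff N l) (risingβ l) k) ⟩
    Σ N (λ l → hypCoeff N l * nth (risingβ l) k)     ∎
    where
    open ≡-Reasoning
    term = hypTerm (oneMinus N) (addP (constP 1ℚ) βP) 1 (ℕtoℚ 2)

  nth-β*hypPoly : ∀ N k → nth (0ℚ ∷ hypPoly N) k ≡ Σ N (λ l → hypCoeff N l * nth (0ℚ ∷ risingβ l) k)
  nth-β*hypPoly N zero    = sym (Σ-zero N (λ l _ → ℚP.*-zeroʳ (hypCoeff N l)))
  nth-β*hypPoly N (suc k) = nth-hypPoly N k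

  nth-hypPoly-≥ : ∀ N k → N ≤ k → nth (hypPoly N) k ≡ 0ℚ
  nth-hypPoly-≥ N k N≤k = trans (nth-hypPoly N k)
    (Σ-zero N (λ l l<N → trans (cong (hypCoeff N l *_) (nth-risingβ-> l k (ℕP.<-≤-trans l<N N≤k))) (ℚP.*-zeroʳ (hypCoeff N l))))

  oneMinus-suc≡ : ∀ M → oneMinus (suc M) ≡ 1ℚ + - (1ℚ + ℕtoℚ M)
  oneMinus-suc≡ M = cong (λ t → 1ℚ + - t) (ℕtoℚ-suc M)

  oneMinus-2+≡ : ∀ M → oneMinus (2 ℕ.+ M) ≡ 1ℚ + - (1ℚ + (1ℚ + ℕtoℚ M))
  oneMinus-2+≡ M = cong (λ t → 1ℚ + - t) (ℕtoℚ-2+ M)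

  pochℚ-oneMinus-suc : ∀ M k → pochℚ (oneMinus (suc M)) (suc k) ≡ oneMinus (suc M) * pochℚ (oneMinus M) k
  pochℚ-oneMinus-suc M k = trans (pochℚ-suc-shift (oneMinus (suc M)) k) (cong (λ t → oneMinus (suc M) * pochℚ t k) (oneMinus-suc M))

  hypCoeff-1 : ∀ N → hypCoeff N 1 ≡ oneMinus N
  hypCoeff-1 N = solve 1 (λ x → con 1ℚ :* (x :+ con 0ℚ) :* (con 1ℚ :* con (ℕtoℚ 2)) :* con ½ := x) refl (oneMinus N)

  -- All coefficients involved are (1 − M)_k 2^(k+1) / ((2)_(k+2) (k+2)!) times a polynomial in M and k.
  hypCoeff-contiguous-2+ : ∀ M k →
    ℕtoℚ (2 ℕ.+ M) * hypCoeff (2 ℕ.+ M) (2 ℕ.+ k)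
      ≡ - ℕtoℚ 2 * (hypCoeff (suc M) (suc k) + - (ℕtoℚ (3 ℕ.+ k) * hypCoeff (suc M) (2 ℕ.+ k))) + ℕtoℚ M * hypCoeff M (2 ℕ.+ k)
  hypCoeff-contiguous-2+ M k = begin
    ℕtoℚ (2 ℕ.+ M) * (pochℚ (oneMinus (2 ℕ.+ M)) (2 ℕ.+ k) * (p * two) * R)
      ≡⟨ cong₂ (λ A B → A * (B * (p * two) * R)) (ℕtoℚ-2+ M) pochℚ-2+ ⟩
    (1ℚ + (1ℚ + m)) * ((a′ * (b′ * r)) * (p * two) * R)
      ≡⟨ solve 5 (λ m K r p R →
           (con 1ℚ :+ (con 1ℚ :+ m)) :* ((A′ m :* (B′ m :* r)) :* (p :* Two) :* R)
           := (:- Two) :* ((B′ m :* r) :* p :* (R :* ((con 1ℚ :+ (con 1ℚ :+ (con 1ℚ :+ K))) :* (con 1ℚ :+ (con 1ℚ :+ K))))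
                         :+ (:- ((con 1ℚ :+ (con 1ℚ :+ (con 1ℚ :+ K))) :* ((B′ m :* r) :* (B′ m :+ (con 1ℚ :+ K)) :* (p :* Two) :* R))))
              :+ m :* (r :* (C′ m :+ K) :* (C′ m :+ (con 1ℚ :+ K)) :* (p :* Two) :* R))
           refl m K r p R ⟩
    - two * ((b′ * r) * p * (R * Q) + - (L3 * ((b′ * r) * (b′ + (1ℚ + K)) * (p * two) * R))) + m * (r * (c′ + K) * (c′ + (1ℚ + K)) * (p * two) * R)
      ≡⟨ sym (cong₂ (λ X W → - two * X + m * W) (cong₂ (λ X Y → X + - Y) e1 (cong₂ _*_ e3 e2)) e4) ⟩
    - two * (hypCoeff (suc M) (suc k) + - (ℕtoℚ (3 ℕ.+ k) * hypCoeff (suc M) (2 ℕ.+ k))) + ℕtoℚ M * hypCoeff M (2 ℕ.+ k) ∎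
    where
    open ≡-Reasoning
    m = ℕtoℚ M
    K = ℕtoℚ k
    a′ = 1ℚ + - (1ℚ + (1ℚ + m))
    b′ = 1ℚ + - (1ℚ + m)
    c′ = 1ℚ + - m
    two = ℕtoℚ 2
    r = pochℚ (oneMinus M) k
    p = powℚ (ℕtoℚ 2) (suc k)
    R = recipHypDenom (2 ℕ.+ k)
    Q = (1ℚ + (1ℚ + (1ℚ + K))) * (1ℚ + (1ℚ + K))
    L3 = 1ℚ + (1ℚ + (1ℚ + K))
    Two : ∀ {n} → Polynomial n
    Two = con (ℕtoℚ 2)
    A′ B′ C′ : ∀ {n} → Polynomial n → Polynomial n
    A′ m = con 1ℚ :+ (:- (con 1ℚ :+ (con 1ℚ :+ m)))
    B′ m = con 1ℚ :+ (:- (con 1ℚ :+ m))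
    C′ m = con 1ℚ :+ (:- m)
    pochℚ-2+ : pochℚ (oneMinus (2 ℕ.+ M)) (2 ℕ.+ k) ≡ a′ * (b′ * r)
    pochℚ-2+ = trans (pochℚ-suc-shift (oneMinus (2 ℕ.+ M)) (suc k))
      (cong₂ _*_ (oneMinus-2+≡ M) (trans (cong (λ t → pochℚ t (suc k)) (oneMinus-suc (suc M)))
        (trans (pochℚ-oneMinus-suc M k) (cong (_* r) (oneMinus-suc≡ M)))))
    e1 : hypCoeff (suc M) (suc k) ≡ (b′ * r) * p * (R * Q)
    e1 = cong₂ (λ X Y → X * p * Y) (trans (pochℚ-oneMinus-suc M k) (cong (_* r) (oneMinus-suc≡ M)))
           (trans (recipHypDenom-suc (suc k))
             (cong (R *_) (trans (ℕtoℚ-* (3 ℕ.+ k) (2 ℕ.+ k)) (cong₂ _*_ (trans (ℕtoℚ-suc (2 ℕ.+ k)) (cong (1ℚ +_) (ℕtoℚ-2+ k))) (ℕtoℚ-2+ k)))))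
    e2 : hypCoeff (suc M) (2 ℕ.+ k) ≡ (b′ * r) * (b′ + (1ℚ + K)) * (p * two) * R
    e2 = cong₂ (λ X Y → X * Y * (p * two) * R) (trans (pochℚ-oneMinus-suc M k) (cong (_* r) (oneMinus-suc≡ M)))
           (cong₂ _+_ (oneMinus-suc≡ M) (ℕtoℚ-suc k))
    e3 : ℕtoℚ (3 ℕ.+ k) ≡ L3
    e3 = trans (ℕtoℚ-suc (2 ℕ.+ k)) (cong (1ℚ +_) (ℕtoℚ-2+ k))
    e4 : hypCoeff M (2 ℕ.+ k) ≡ r * (c′ + K) * (c′ + (1ℚ + K)) * (p * two) * R
    e4 = cong (λ X → r * (c′ + K) * (c′ + X) * (p * two) * R) (ℕtoℚ-suc k)

  hypCoeff-contiguous : ∀ M l →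
    ℕtoℚ (2 ℕ.+ M) * hypCoeff (2 ℕ.+ M) l
      ≡ - ℕtoℚ 2 * (shift (hypCoeff (suc M)) l + - (ℕtoℚ (suc l) * hypCoeff (suc M) l)) + ℕtoℚ M * hypCoeff M l
  hypCoeff-contiguous M zero = trans (cong (_* 1ℚ) (ℕtoℚ-2+ M))
    (solve 1 (λ m → (con 1ℚ :+ (con 1ℚ :+ m)) :* con 1ℚ
                    := (:- con (ℕtoℚ 2)) :* (con 0ℚ :+ (:- (con 1ℚ :* con 1ℚ))) :+ m :* con 1ℚ) refl (ℕtoℚ M))
  hypCoeff-contiguous M (suc zero) = begin
    ℕtoℚ (2 ℕ.+ M) * hypCoeff (2 ℕ.+ M) 1
      ≡⟨ cong₂ _*_ (ℕtoℚ-2+ M) (trans (hypCoeff-1 (2 ℕ.+ M)) (oneMinus-2+≡ M)) ⟩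
    (1ℚ + (1ℚ + m)) * (1ℚ + - (1ℚ + (1ℚ + m)))
      ≡⟨ solve 1 (λ m → (con 1ℚ :+ (con 1ℚ :+ m)) :* (con 1ℚ :+ (:- (con 1ℚ :+ (con 1ℚ :+ m))))
                       := (:- con (ℕtoℚ 2)) :* (con 1ℚ :+ (:- (con (ℕtoℚ 2) :* (con 1ℚ :+ (:- (con 1ℚ :+ m)))))) :+ m :* (con 1ℚ :+ (:- m))) refl m ⟩
    - ℕtoℚ 2 * (1ℚ + - (ℕtoℚ 2 * (1ℚ + - (1ℚ + m)))) + m * (1ℚ + - m)
      ≡⟨ sym (cong₂ (λ X Y → - ℕtoℚ 2 * (1ℚ + - (ℕtoℚ 2 * X)) + m * Y) (trans (hypCoeff-1 (suc M)) (oneMinus-suc≡ M)) (hypCoeff-1 M)) ⟩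
    - ℕtoℚ 2 * (shift (hypCoeff (suc M)) 1 + - (ℕtoℚ 2 * hypCoeff (suc M) 1)) + ℕtoℚ M * hypCoeff M 1 ∎
    where
    open ≡-Reasoning
    m = ℕtoℚ M
  hypCoeff-contiguous M (suc (suc k)) = hypCoeff-contiguous-2+ M k

  Σ-shift-hypCoeff≡nth-β*hypPoly : ∀ M k →
    Σ (3 ℕ.+ M) (λ l → shift (hypCoeff (suc M)) l * nth (risingβ l) k + - (ℕtoℚ (suc l) * hypCoeff (suc M) l) * nth (risingβ l) k)
      ≡ nth (0ℚ ∷ hypPoly (suc M)) k
  Σ-shift-hypCoeff≡nth-β*hypPoly M k = begin
    Σ (3 ℕ.+ M) (λ l → shifted l + lowered l)
      ≡⟨ Σ-+ (3 ℕ.+ M) shifted lowered ⟩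
    Σ (3 ℕ.+ M) shifted + Σ (3 ℕ.+ M) lowered
      ≡⟨ cong₂ _+_ (Σ-vanishing-tail (2 ℕ.+ M) (3 ℕ.+ M) shifted shifted-tail (ℕP.n≤1+n _))
                   (Σ-vanishing-tail (suc M) (3 ℕ.+ M) lowered lowered-tail (ℕP.m≤n+m (suc M) 2)) ⟩
    (0ℚ * P 0 + Σ (suc M) (λ l → c l * P (suc l))) + Σ (suc M) lowered
      ≡⟨ cong (_+ Σ (suc M) lowered) (trans (cong (_+ Σ (suc M) (λ l → c l * P (suc l))) (ℚP.*-zeroˡ (P 0))) (ℚP.+-identityˡ (Σ (suc M) (λ l → c l * P (suc l))))) ⟩
    Σ (suc M) (λ l → c l * P (suc l)) + Σ (suc M) lowered
      ≡⟨ sym (Σ-+ (suc M) (λ l → c l * P (suc l)) lowered) ⟩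
    Σ (suc M) (λ l → c l * P (suc l) + lowered l)
      ≡⟨ Σ-cong′ (suc M) (λ l → trans (cong (λ t → c l * t + lowered l) (nth-risingβ-suc l k))
           (solve 4 (λ c L q q′ → c :* (L :* q :+ q′) :+ (:- (L :* c)) :* q := c :* q′) refl (c l) (ℕtoℚ (suc l)) (P l) (P′ l))) ⟩
    Σ (suc M) (λ l → c l * P′ l)
      ≡⟨ sym (nth-β*hypPoly (suc M) k) ⟩
    nth (0ℚ ∷ hypPoly (suc M)) k ∎
    where
    open ≡-Reasoning
    c = hypCoeff (suc M)
    P P′ : ℕ → ℚ
    P l = nth (risingβ l) k
    P′ l = nth (0ℚ ∷ risingβ l) k
    shifted lowered : ℕ → ℚ
    shifted l = shift c l * P l
    lowered l = - (ℕtoℚ (suc l) * c l) * P l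
    shifted-tail : ∀ l → 2 ℕ.+ M ≤ l → shifted l ≡ 0ℚ
    shifted-tail (suc l) (s≤s M<l) = trans (cong (_* P (suc l)) (hypCoeff-> M l M<l)) (ℚP.*-zeroˡ (P (suc l)))
    lowered-tail : ∀ l → suc M ≤ l → lowered l ≡ 0ℚ
    lowered-tail l M<l = trans (cong (λ t → - (ℕtoℚ (suc l) * t) * P l) (hypCoeff-> M l M<l))
      (solve 2 (λ a b → (:- (a :* con 0ℚ)) :* b := con 0ℚ) refl (ℕtoℚ (suc l)) (P l))

  Σ-ℕtoℚ*hypCoeff : ∀ M Z k → M ≤ Z →
    Σ Z (λ l → ℕtoℚ M * (hypCoeff M l * nth (risingβ l) k)) ≡ ℕtoℚ M * nth (hypPoly M) k
  Σ-ℕtoℚ*hypCoeff M Z k M≤Z = begin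
    Σ Z (λ l → ℕtoℚ M * (hypCoeff M l * nth (risingβ l) k))   ≡⟨ Σ-vanishing-tail M Z _ (tail M) M≤Z ⟩
    Σ M (λ l → ℕtoℚ M * (hypCoeff M l * nth (risingβ l) k))   ≡⟨ sym (Σ-*ˡ M (ℕtoℚ M) (λ l → hypCoeff M l * nth (risingβ l) k)) ⟩
    ℕtoℚ M * Σ M (λ l → hypCoeff M l * nth (risingβ l) k)     ≡⟨ cong (ℕtoℚ M *_) (sym (nth-hypPoly M k)) ⟩
    ℕtoℚ M * nth (hypPoly M) k                               ∎
    where
    open ≡-Reasoning
    -- for M = 0 the factor ℕtoℚ M vanishes; otherwise the coefficients do
    tail : ∀ M l → M ≤ l → ℕtoℚ M * (hypCoeff M l * nth (risingβ l) k) ≡ 0ℚ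
    tail zero     l _   = ℚP.*-zeroˡ (hypCoeff 0 l * nth (risingβ l) k)
    tail (suc M′) l M≤l = trans (cong (λ t → ℕtoℚ (suc M′) * (t * nth (risingβ l) k)) (hypCoeff-> M′ l M≤l))
      (solve 2 (λ a b → a :* (con 0ℚ :* b) := con 0ℚ) refl (ℕtoℚ (suc M′)) (nth (risingβ l) k))

  nth-hypPoly-contiguous : ∀ M k →
    ℕtoℚ (2 ℕ.+ M) * nth (hypPoly (2 ℕ.+ M)) k ≡ - ℕtoℚ 2 * nth (0ℚ ∷ hypPoly (suc M)) k + ℕtoℚ M * nth (hypPoly M) k
  nth-hypPoly-contiguous M k = begin
    ℕtoℚ (2 ℕ.+ M) * nth (hypPoly (2 ℕ.+ M)) k
      ≡⟨ cong (ℕtoℚ (2 ℕ.+ M) *_) (nth-hypPoly (2 ℕ.+ M) k) ⟩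
    ℕtoℚ (2 ℕ.+ M) * Σ (2 ℕ.+ M) (λ l → hypCoeff (2 ℕ.+ M) l * P l)
      ≡⟨ Σ-*ˡ (2 ℕ.+ M) (ℕtoℚ (2 ℕ.+ M)) (λ l → hypCoeff (2 ℕ.+ M) l * P l) ⟩
    Σ (2 ℕ.+ M) (λ l → ℕtoℚ (2 ℕ.+ M) * (hypCoeff (2 ℕ.+ M) l * P l))
      ≡⟨ sym (Σ-vanishing-tail (2 ℕ.+ M) (3 ℕ.+ M) _ top-tail (ℕP.n≤1+n _)) ⟩
    Σ (3 ℕ.+ M) (λ l → ℕtoℚ (2 ℕ.+ M) * (hypCoeff (2 ℕ.+ M) l * P l))
      ≡⟨ Σ-cong′ (3 ℕ.+ M) (λ l → trans (sym (ℚP.*-assoc (ℕtoℚ (2 ℕ.+ M)) _ (P l))) (cong (_* P l) (hypCoeff-contiguous M l))) ⟩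
    Σ (3 ℕ.+ M) (λ l → (- ℕtoℚ 2 * (shifted l + - (ℕtoℚ (suc l) * c₁ l)) + m * c₀ l) * P l)
      ≡⟨ Σ-cong′ (3 ℕ.+ M) (λ l → solve 6 (λ d L c m c₀ q → ((:- con (ℕtoℚ 2)) :* (d :+ (:- (L :* c))) :+ m :* c₀) :* q
                                  := (:- con (ℕtoℚ 2)) :* (d :* q :+ (:- (L :* c)) :* q) :+ m :* (c₀ :* q))
                                  refl (shifted l) (ℕtoℚ (suc l)) (c₁ l) m (c₀ l) (P l)) ⟩
    Σ (3 ℕ.+ M) (λ l → - ℕtoℚ 2 * (shifted l * P l + - (ℕtoℚ (suc l) * c₁ l) * P l) + m * (c₀ l * P l))
      ≡⟨ Σ-+ (3 ℕ.+ M) (λ l → - ℕtoℚ 2 * lowering l) (λ l → m * (c₀ l * P l)) ⟩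
    Σ (3 ℕ.+ M) (λ l → - ℕtoℚ 2 * lowering l) + Σ (3 ℕ.+ M) (λ l → m * (c₀ l * P l))
      ≡⟨ cong₂ _+_ (sym (Σ-*ˡ (3 ℕ.+ M) (- ℕtoℚ 2) lowering)) (Σ-ℕtoℚ*hypCoeff M (3 ℕ.+ M) k (ℕP.m≤n+m M 3)) ⟩
    - ℕtoℚ 2 * Σ (3 ℕ.+ M) (λ l → shifted l * P l + - (ℕtoℚ (suc l) * c₁ l) * P l) + m * nth (hypPoly M) k
      ≡⟨ cong (λ t → - ℕtoℚ 2 * t + m * nth (hypPoly M) k) (Σ-shift-hypCoeff≡nth-β*hypPoly M k) ⟩
    - ℕtoℚ 2 * nth (0ℚ ∷ hypPoly (suc M)) k + m * nth (hypPoly M) k ∎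
    where
    open ≡-Reasoning
    m = ℕtoℚ M
    c₁ = hypCoeff (suc M)
    c₀ = hypCoeff M
    shifted = shift (hypCoeff (suc M))
    P lowering : ℕ → ℚ
    P l = nth (risingβ l) k
    lowering l = shifted l * P l + - (ℕtoℚ (suc l) * c₁ l) * P l
    top-tail : ∀ l → 2 ℕ.+ M ≤ l → ℕtoℚ (2 ℕ.+ M) * (hypCoeff (2 ℕ.+ M) l * P l) ≡ 0ℚ
    top-tail l M+1<l = trans (cong (λ t → ℕtoℚ (2 ℕ.+ M) * (t * P l)) (hypCoeff-> (suc M) l M+1<l))
      (solve 2 (λ a b → a :* (con 0ℚ :* b) := con 0ℚ) refl (ℕtoℚ (2 ℕ.+ M)) (P l))

  -- the umbral image of β^s · ₂F₁(1 − N, 1 + β; 2 | 2)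
  hypUmbral : ℕ → ℕ → ℚ
  hypUmbral N s = Σ N (λ k → nth (hypPoly N) k * umbralCoeff (s ℕ.+ k))

  hypUmbral-contiguous : ∀ M t →
    ℕtoℚ (2 ℕ.+ M) * hypUmbral (2 ℕ.+ M) t ≡ - ℕtoℚ 2 * hypUmbral (suc M) (suc t) + ℕtoℚ M * hypUmbral M t
  hypUmbral-contiguous M t = begin
    ℕtoℚ (2 ℕ.+ M) * Σ (2 ℕ.+ M) (λ k → H₂ k * u k)
      ≡⟨ Σ-*ˡ (2 ℕ.+ M) (ℕtoℚ (2 ℕ.+ M)) (λ k → H₂ k * u k) ⟩
    Σ (2 ℕ.+ M) (λ k → ℕtoℚ (2 ℕ.+ M) * (H₂ k * u k))
      ≡⟨ Σ-cong′ (2 ℕ.+ M) (λ k → trans (sym (ℚP.*-assoc (ℕtoℚ (2 ℕ.+ M)) (H₂ k) (u k))) (cong (_* u k) (nth-hypPoly-contiguous M k))) ⟩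
    Σ (2 ℕ.+ M) (λ k → (- ℕtoℚ 2 * βH₁ k + m * H₀ k) * u k)
      ≡⟨ Σ-cong′ (2 ℕ.+ M) (λ k → solve 4 (λ x m y w → ((:- con (ℕtoℚ 2)) :* x :+ m :* y) :* w := (:- con (ℕtoℚ 2)) :* (x :* w) :+ m :* (y :* w))
                                     refl (βH₁ k) m (H₀ k) (u k)) ⟩
    Σ (2 ℕ.+ M) (λ k → - ℕtoℚ 2 * (βH₁ k * u k) + m * (H₀ k * u k))
      ≡⟨ Σ-+ (2 ℕ.+ M) (λ k → - ℕtoℚ 2 * (βH₁ k * u k)) (λ k → m * (H₀ k * u k)) ⟩
    Σ (2 ℕ.+ M) (λ k → - ℕtoℚ 2 * (βH₁ k * u k)) + Σ (2 ℕ.+ M) (λ k → m * (H₀ k * u k))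
      ≡⟨ cong₂ _+_ (sym (Σ-*ˡ (2 ℕ.+ M) (- ℕtoℚ 2) (λ k → βH₁ k * u k))) (sym (Σ-*ˡ (2 ℕ.+ M) m (λ k → H₀ k * u k))) ⟩
    - ℕtoℚ 2 * Σ (2 ℕ.+ M) (λ k → βH₁ k * u k) + m * Σ (2 ℕ.+ M) (λ k → H₀ k * u k)
      ≡⟨ cong₂ (λ x y → - ℕtoℚ 2 * x + m * y) β-shift H₀-tail ⟩
    - ℕtoℚ 2 * hypUmbral (suc M) (suc t) + m * hypUmbral M t ∎
    where
    open ≡-Reasoning
    m = ℕtoℚ M
    u : ℕ → ℚ
    u k = umbralCoeff (t ℕ.+ k)
    H₂ H₀ βH₁ : ℕ → ℚ
    H₂ = nth (hypPoly (2 ℕ.+ M))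
    H₀ = nth (hypPoly M)
    βH₁ = nth (0ℚ ∷ hypPoly (suc M))
    β-shift : Σ (2 ℕ.+ M) (λ k → βH₁ k * u k) ≡ hypUmbral (suc M) (suc t)
    β-shift = begin
      0ℚ * u 0 + Σ (suc M) (λ k → nth (hypPoly (suc M)) k * u (suc k))
        ≡⟨ cong₂ _+_ (ℚP.*-zeroˡ (u 0)) (Σ-cong′ (suc M) (λ k → cong (λ i → nth (hypPoly (suc M)) k * umbralCoeff i) (ℕP.+-suc t k))) ⟩
      0ℚ + hypUmbral (suc M) (suc t)   ≡⟨ ℚP.+-identityˡ (hypUmbral (suc M) (suc t)) ⟩
      hypUmbral (suc M) (suc t)        ∎
    H₀-tail : Σ (2 ℕ.+ M) (λ k → H₀ k * u k) ≡ hypUmbral M t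
    H₀-tail = Σ-vanishing-tail M (2 ℕ.+ M) (λ k → H₀ k * u k)
      (λ k M≤k → trans (cong (_* u k) (nth-hypPoly-≥ M k M≤k)) (ℚP.*-zeroˡ (u k))) (ℕP.m≤n+m M 2)

  umbral-scaleP-shiftP : ∀ c s p L → (∀ k → L ≤ k → nth p k ≡ 0ℚ) →
    umbral (scaleP c (shiftP s p)) ≡ c * Σ L (λ k → nth p k * umbralCoeff (s ℕ.+ k))
  umbral-scaleP-shiftP c s p L vanish = begin
    umbral (scaleP c (shiftP s p))
      ≡⟨ umbral-truncate (scaleP c (shiftP s p)) (s ℕ.+ L) beyond ⟩
    Σ (s ℕ.+ L) F
      ≡⟨ Σ-split s L F ⟩
    Σ s F + Σ L (λ k → F (s ℕ.+ k))
      ≡⟨ cong₂ _+_ (Σ-zero s below) (Σ-cong′ L (λ k → cong (_* umbralCoeff (s ℕ.+ k)) (coeff-+ k))) ⟩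
    0ℚ + Σ L (λ k → c * nth p k * umbralCoeff (s ℕ.+ k))
      ≡⟨ ℚP.+-identityˡ _ ⟩
    Σ L (λ k → c * nth p k * umbralCoeff (s ℕ.+ k))
      ≡⟨ Σ-cong′ L (λ k → ℚP.*-assoc c (nth p k) (umbralCoeff (s ℕ.+ k))) ⟩
    Σ L (λ k → c * (nth p k * umbralCoeff (s ℕ.+ k)))
      ≡⟨ sym (Σ-*ˡ L c (λ k → nth p k * umbralCoeff (s ℕ.+ k))) ⟩
    c * Σ L (λ k → nth p k * umbralCoeff (s ℕ.+ k)) ∎
    where
    open ≡-Reasoning
    q = scaleP c (shiftP s p)
    F : ℕ → ℚ
    F k = nth q k * umbralCoeff k
    coeff-+ : ∀ k → nth q (s ℕ.+ k) ≡ c * nth p k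
    coeff-+ k = trans (nth-scaleP c (shiftP s p) (s ℕ.+ k)) (cong (c *_) (nth-shiftP-+ s p k))
    below : ∀ k → k < s → F k ≡ 0ℚ
    below k k<s = trans (cong (_* umbralCoeff k) (trans (nth-scaleP c (shiftP s p) k)
      (trans (cong (c *_) (nth-shiftP-< s p k k<s)) (ℚP.*-zeroʳ c)))) (ℚP.*-zeroˡ (umbralCoeff k))
    beyond : ∀ k → s ℕ.+ L ≤ k → nth q k ≡ 0ℚ
    beyond k s+L≤k = begin
      nth q k                     ≡⟨ cong (nth q) (sym (ℕP.m+[n∸m]≡n s≤k)) ⟩
      nth q (s ℕ.+ (k ∸ s))       ≡⟨ coeff-+ (k ∸ s) ⟩
      c * nth p (k ∸ s)           ≡⟨ cong (c *_) (vanish (k ∸ s) L≤k-s) ⟩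
      c * 0ℚ                      ≡⟨ ℚP.*-zeroʳ c ⟩
      0ℚ                          ∎
      where
      s≤k : s ≤ k
      s≤k = ℕP.≤-trans (ℕP.m≤m+n s L) s+L≤k
      L≤k-s : L ≤ k ∸ s
      L≤k-s = subst (_≤ k ∸ s) (ℕP.m+n∸m≡n s L) (ℕP.∸-monoˡ-≤ s s+L≤k)

  -- Both sides satisfy the same three-term recurrence in N

  -- the right-hand side divided by (2n)!, as a function of N and t = 2n − N
  normalisedRHS : ℕ → ℕ → ℚ
  normalisedRHS N t = invFact t * (ℕtoℚ 2 * powℚ ½ N) * ℕtoℚ N * hypUmbral N (suc t)

  recipℕ-2^pred-* : ∀ N → recipℕ (2 ^ (N ∸ 1)) {{m^n≢0 2 (N ∸ 1)}} * ℕtoℚ N ≡ ℕtoℚ 2 * powℚ ½ N * ℕtoℚ N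
  recipℕ-2^pred-* zero    = refl
  recipℕ-2^pred-* (suc k) = cong (_* ℕtoℚ (suc k)) (trans (recipℕ-2^≡½^ k)
    (solve 1 (λ p → p := con (ℕtoℚ 2) :* (p :* con ½)) refl (powℚ ½ k)))

  umbral-rhsPoly : ∀ N n → umbral (rhsPoly N n) ≡ ℕtoℚ ((2 ℕ.* n) !) * normalisedRHS N (2 ℕ.* n ∸ N)
  umbral-rhsPoly N n = begin
    umbral (rhsPoly N n)
      ≡⟨ umbral-scaleP-shiftP (((ℤ.+ F) // (t !)) {{t !≢0}} * R * ℕtoℚ N) (t ℕ.+ 1) (hypPoly N) N (nth-hypPoly-≥ N) ⟩
    (((ℤ.+ F) // (t !)) {{t !≢0}} * R * ℕtoℚ N) * Σ N (λ k → nth (hypPoly N) k * umbralCoeff (t ℕ.+ 1 ℕ.+ k))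
      ≡⟨ cong₂ (λ x s → x * R * ℕtoℚ N * hypUmbral N s) (//≡ℕtoℚ*recipℕ F (t !) {{t !≢0}}) (ℕP.+-comm t 1) ⟩
    ℕtoℚ F * invFact t * R * ℕtoℚ N * H
      ≡⟨ solve 5 (λ f i r n h → f :* i :* r :* n :* h := f :* (i :* (r :* n) :* h)) refl (ℕtoℚ F) (invFact t) R (ℕtoℚ N) H ⟩
    ℕtoℚ F * (invFact t * (R * ℕtoℚ N) * H)
      ≡⟨ cong (λ x → ℕtoℚ F * (invFact t * x * H)) (recipℕ-2^pred-* N) ⟩
    ℕtoℚ F * (invFact t * (ℕtoℚ 2 * powℚ ½ N * ℕtoℚ N) * H)
      ≡⟨ cong (ℕtoℚ F *_) (solve 5 (λ i two p n h → i :* (two :* p :* n) :* h := i :* (two :* p) :* n :* h) refl (invFact t) (ℕtoℚ 2) (powℚ ½ N) (ℕtoℚ N) H) ⟩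
    ℕtoℚ F * normalisedRHS N t ∎
    where
    open ≡-Reasoning
    F = (2 ℕ.* n) !
    t = 2 ℕ.* n ∸ N
    R = recipℕ (2 ^ (N ∸ 1)) {{m^n≢0 2 (N ∸ 1)}}
    H = hypUmbral N (suc t)

  normalisedRHS-recurrence : ∀ M t →
    ℕtoℚ (suc M) * normalisedRHS (2 ℕ.+ M) t
      ≡ - ℕtoℚ (suc t) * normalisedRHS (suc M) (suc t) + ½ * ½ * ℕtoℚ (suc M) * normalisedRHS M t
  normalisedRHS-recurrence M t = begin
    ℕtoℚ (suc M) * (invFact t * (ℕtoℚ 2 * (p * ½ * ½)) * ℕtoℚ (2 ℕ.+ M) * H₂)
      ≡⟨ solve 5 (λ k r p k₂ h → k :* (r :* (con (ℕtoℚ 2) :* (p :* con ½ :* con ½)) :* k₂ :* h) := k :* r :* p :* con ½ :* (k₂ :* h))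
                 refl (ℕtoℚ (suc M)) (invFact t) p (ℕtoℚ (2 ℕ.+ M)) H₂ ⟩
    ℕtoℚ (suc M) * invFact t * p * ½ * (ℕtoℚ (2 ℕ.+ M) * H₂)
      ≡⟨ cong (ℕtoℚ (suc M) * invFact t * p * ½ *_) (hypUmbral-contiguous M (suc t)) ⟩
    ℕtoℚ (suc M) * invFact t * p * ½ * (- ℕtoℚ 2 * H₁ + ℕtoℚ M * H₀)
      ≡⟨ cong (λ r → ℕtoℚ (suc M) * r * p * ½ * (- ℕtoℚ 2 * H₁ + ℕtoℚ M * H₀)) (invFact-suc t) ⟩
    ℕtoℚ (suc M) * (r′ * ℕtoℚ (suc t)) * p * ½ * (- ℕtoℚ 2 * H₁ + ℕtoℚ M * H₀)
      ≡⟨ solve 7 (λ k r′ t p m h₁ h₀ →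
            k :* (r′ :* t) :* p :* con ½ :* ((:- con (ℕtoℚ 2)) :* h₁ :+ m :* h₀)
            := (:- t) :* (r′ :* (con (ℕtoℚ 2) :* (p :* con ½)) :* k :* h₁) :+ con ½ :* con ½ :* k :* ((r′ :* t) :* (con (ℕtoℚ 2) :* p) :* m :* h₀))
            refl (ℕtoℚ (suc M)) r′ (ℕtoℚ (suc t)) p (ℕtoℚ M) H₁ H₀ ⟩
    - ℕtoℚ (suc t) * (r′ * (ℕtoℚ 2 * (p * ½)) * ℕtoℚ (suc M) * H₁) + ½ * ½ * ℕtoℚ (suc M) * ((r′ * ℕtoℚ (suc t)) * (ℕtoℚ 2 * p) * ℕtoℚ M * H₀)
      ≡⟨ cong (λ r → - ℕtoℚ (suc t) * normalisedRHS (suc M) (suc t) + ½ * ½ * ℕtoℚ (suc M) * (r * (ℕtoℚ 2 * p) * ℕtoℚ M * H₀)) (sym (invFact-suc t)) ⟩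
    - ℕtoℚ (suc t) * normalisedRHS (suc M) (suc t) + ½ * ½ * ℕtoℚ (suc M) * normalisedRHS M t ∎
    where
    open ≡-Reasoning
    p = powℚ ½ M
    r′ = invFact (suc t)
    H₂ = hypUmbral (2 ℕ.+ M) (suc t)
    H₁ = hypUmbral (suc M) (2 ℕ.+ t)
    H₀ = hypUmbral M (suc t)

  MatchesNormalisedRHS : ℕ → Set
  MatchesNormalisedRHS N = ∀ n t → 0 < t → N ℕ.+ t ≡ 2 ℕ.* n → (bernoulliEvenGF ^ˢ N) n ≡ normalisedRHS N t

  matches-0 : MatchesNormalisedRHS 0
  matches-0 zero    (suc t) _ ()
  matches-0 (suc n) t       _ _ = sym (solve 3 (λ i p h → i :* (con (ℕtoℚ 2) :* p) :* con 0ℚ :* h := con 0ℚ) refl (invFact t) (powℚ ½ 0) (hypUmbral 0 (suc t)))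

  matches-1 : MatchesNormalisedRHS 1
  matches-1 n t _ 1+t≡2n = begin
    (g ⋆ one) n                                          ≡⟨ ⋆-identityʳ g n ⟩
    invFact (2 ℕ.* n) * B (2 ℕ.* n)                      ≡⟨ cong (λ k → invFact k * B k) (sym 1+t≡2n) ⟩
    invFact (suc t) * B (suc t)                          ≡⟨ cong (_* B (suc t)) (recipℕ-* (suc t) (t !) {{_}} {{t !≢0}} {{suc t !≢0}}) ⟩
    recipℕ (suc t) * invFact t * B (suc t)
      ≡⟨ solve 3 (λ r i b → r :* i :* b := i :* (con (ℕtoℚ 2) :* (con 1ℚ :* con ½)) :* con 1ℚ :* (con 1ℚ :* (b :* r) :+ con 0ℚ))
                 refl (recipℕ (suc t)) (invFact t) (B (suc t)) ⟩
    invFact t * (ℕtoℚ 2 * powℚ ½ 1) * ℕtoℚ 1 * (1ℚ * umbralCoeff (suc t) + 0ℚ)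
      ≡⟨ cong (λ k → invFact t * (ℕtoℚ 2 * powℚ ½ 1) * ℕtoℚ 1 * (1ℚ * umbralCoeff k + 0ℚ)) (sym (ℕP.+-identityʳ (suc t))) ⟩
    normalisedRHS 1 t                                    ∎
    where
    open ≡-Reasoning
    g = bernoulliEvenGF

  matches-2+ : ∀ M → MatchesNormalisedRHS M → MatchesNormalisedRHS (suc M) → MatchesNormalisedRHS (2 ℕ.+ M)
  matches-2+ M matches-M matches-1+M (suc n) t 0<t 2+M+t≡2n = *-cancelˡ-ℕtoℚ (suc M) (begin
    ℕtoℚ (suc M) * (g ^ˢ (2 ℕ.+ M)) (suc n)
      ≡⟨ bernoulliEvenGF^-recurrence M t n M+t≡2n ⟩
    - ℕtoℚ (suc t) * (g ^ˢ suc M) (suc n) + ½ * ½ * ℕtoℚ (suc M) * (g ^ˢ M) n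
      ≡⟨ cong₂ (λ x y → - ℕtoℚ (suc t) * x + ½ * ½ * ℕtoℚ (suc M) * y)
               (matches-1+M (suc n) (suc t) (s≤s z≤n) (trans (ℕP.+-suc (suc M) t) 2+M+t≡2n)) (matches-M n t 0<t M+t≡2n) ⟩
    - ℕtoℚ (suc t) * normalisedRHS (suc M) (suc t) + ½ * ½ * ℕtoℚ (suc M) * normalisedRHS M t
      ≡⟨ sym (normalisedRHS-recurrence M t) ⟩
    ℕtoℚ (suc M) * normalisedRHS (2 ℕ.+ M) t ∎)
    where
    open ≡-Reasoning
    g = bernoulliEvenGF
    M+t≡2n : M ℕ.+ t ≡ 2 ℕ.* n
    M+t≡2n = ℕP.suc-injective (ℕP.suc-injective (trans 2+M+t≡2n (ℕP.*-suc 2 n)))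

  bernoulliEvenGF^≡normalisedRHS : ∀ N → MatchesNormalisedRHS N
  bernoulliEvenGF^≡normalisedRHS zero          = matches-0
  bernoulliEvenGF^≡normalisedRHS (suc zero)    = matches-1
  bernoulliEvenGF^≡normalisedRHS (suc (suc M)) =
    matches-2+ M (bernoulliEvenGF^≡normalisedRHS M) (bernoulliEvenGF^≡normalisedRHS (suc M))

  S≡factorial*normalisedRHS : ∀ N n → N < 2 ℕ.* n → S N n ≡ ℕtoℚ ((2 ℕ.* n) !) * normalisedRHS N (2 ℕ.* n ∸ N)
  S≡factorial*normalisedRHS N n N<2n = trans (S≡bernoulliEvenGF^ N n)
    (cong (ℕtoℚ ((2 ℕ.* n) !) *_) (bernoulliEvenGF^≡normalisedRHS N n (2 ℕ.* n ∸ N) (ℕP.m<n⇒0<n∸m N<2n) (ℕP.m+[n∸m]≡n (ℕP.<⇒≤ N<2n))))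


open BernoulliConvolutionIdentity using (normalisedRHS; S≡factorial*normalisedRHS; umbral-rhsPoly)
open import Data.Nat using (ℕ; _≤_; _<_; _*_; _∸_; _!)
import Data.Rational as ℚ
open import Relation.Binary.PropositionalEquality using (_≡_; sym; module ≡-Reasoning)

-- The case N = 0 holds as well (both sides vanish).
proposition5p3 : (N n : ℕ) → 1 ≤ N → N < 2 * n →
    S N n ≡ umbral (rhsPoly N n)
proposition5p3 N n _ N<2n = begin
  S N n                                               ≡⟨ S≡factorial*normalisedRHS N n N<2n ⟩
  ℕtoℚ ((2 * n) !) ℚ.* normalisedRHS N (2 * n ∸ N)    ≡⟨ sym (umbral-rhsPoly N n) ⟩
  umbral (rhsPoly N n)                                ∎
  where open ≡-Reasoning
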